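{- Let $\rho=l\to r$ be a linear term rewrite rule over a signature $\Sigma$ and let $s,t$ be linear terms. If $s\to t$ via $\rho$ at position $p$, then $s^\circ\Rightarrow t^\circ$ via $\rho^\circ$ at position $p$ (a PBPO$^+$ rewrite step in $\mathbf{Graph}(\Sigma^\circ)$ whose match maps the root of $l^\circ$ to the vertex of $s^\circ$ at position $p$).
   Context: Terms over signature $\Sigma$ (arities $\#$) and variables $\mathcal{X}$; linear = each variable at most once; positions: sequences of positive integers ($\epsilon$ root; $pi$ the $i$-th argument below $p$). A rule $l\to r$ has $l\notin\mathcal{X}$, $\mathrm{Var}(r)\subseteq\mathrm{Var}(l)$; linear if $l,r$ linear. $s\to t$ via $\rho$ at position $p$ means $s=C[l\sigma]$, $t=C[r\sigma]$ for a context $C$ (term with one hole) whose hole is at position $p$ and a substitution $\sigma$. $\mathbf{Graph}(\Sigma^\circ)$: graphs with vertex and edge labels in the flat lattice $\Sigma^\circ=(\Sigma\uplus\mathbb{N}^+)\uplus\{\bot,\top\}$ ($\bot$ least, $\top$ greatest, others incomparable); morphisms commute with source/target and satisfy $\ell(x)\le\ell(\phi(x))$. PBPO$^+$: a rule is $L,K,R,L',K'$ with $l:K\to L$, $r:K\to R$, $l':K'\to L'$, monos $t_L:L\rightarrowtail L'$, $t_K:K\rightarrowtail K'$, $t_L\circ l=l'\circ t_K$ a pullback. A step $G_L\Rightarrow G_R$: a mono $m:L\rightarrowtail G_L$ and $\alpha:G_L\to L'$ with $\alpha\circ m=t_L$ and ($L$, $1_L$, $m$) a pullback of $t_L,\alpha$;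 $(G_K,g_L,u')$ a pullback of $\alpha,l'$; $u:K\to G_K$ the unique morphism with $u'\circ u=t_K$, $g_L\circ u=m\circ l$; $G_R$ a pushout of $u$ and $r$. Encodings: $t^\circ$ has a vertex $p$ labeled $f$ per position $p$ holding symbol $f$, a vertex $x$ labeled $\bot$ per variable $x$ of $t$, and an edge labeled $i$ from the vertex at $p$ to the vertex at $pi$; root at $\epsilon$; vertices carry their positions. The context closure $\mathcal{C}[G{\downarrow_\mathcal{X}}]$ of a rooted graph: relabel each variable vertex $x$ to $\top$ and add a fresh $\top$-vertex $x'$ with $\top$-edges $x\to x'$, $x'\to x'$; add a fresh $\top$-vertex $\mathcal{C}$ with $\top$-edges $\mathcal{C}\to$ root and $\mathcal{C}\to\mathcal{C}$. $\mathcal{I}(r)$: discrete graph on $\mathrm{Var}(r)\cup\{\epsilon\}$ labeled $\bot$, root $\epsilon$. $\rho^\circ$: $L=l^\circ$, $K=\mathcal{I}(r)$, $R=r^\circ$, $L'=\mathcal{C}[l^\circ{\downarrow_\mathcal{X}}]$, $K'=\mathcal{C}[\mathcal{I}(r){\downarrow_\mathcal{X}}]$; $l,r,l',t_L,t_K$ map roots to roots and are inclusions otherwise. -}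

module Defs where

open import Data.Nat using (ℕ; zero; suc; _+_; _≤_; _≡ᵇ_)
open import Data.Nat.Properties using (≡⇒≡ᵇ)
open import Data.Fin using (Fin; zero; suc; toℕ; _≟_)
open import Data.Bool using (Bool; true; false; T; _∨_)
open import Data.Unit using (⊤; tt)
open import Data.Empty using (⊥; ⊥-elim)
open import Data.Sum using (_⊎_; inj₁; inj₂)
open import Data.Product using (Σ; _×_; _,_)
open import Data.List using (List; []; _∷_)
open import Relation.Binary.PropositionalEquality using (_≡_; refl; trans; cong)
open import Relation.Nullary using (yes; no)

record Signature : Set₁ where
  field
    Sym : Set
    ar  : Sym → ℕ

anyFin : (n : ℕ) → (Fin n → Bool) → Bool
anyFin zero    g = false
anyFin (suc n) g = g zero ∨ anyFin n (λ j → g (suc j))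

anyFin-intro : ∀ n (g : Fin n → Bool) i → T (g i) → T (anyFin n g)
anyFin-intro (suc n) g zero h with g zero
... | true  = tt
... | false = ⊥-elim h
anyFin-intro (suc n) g (suc i) h with g zero
... | true  = tt
... | false = anyFin-intro n (λ j → g (suc j)) i h

sumFin : (n : ℕ) → (Fin n → ℕ) → ℕ
sumFin zero    g = 0
sumFin (suc n) g = g zero + sumFin n (λ j → g (suc j))

module Sig (𝕊 : Signature) where
  open Signature 𝕊

  data Term : Set where
    var : ℕ → Term
    fun : (f : Sym) → (Fin (ar f) → Term) → Term

  -- positions: lists of positive integers (argument i : Fin (ar f) is
  -- the (1 + toℕ i)-th argument)
  Pos : Set
  Pos = List ℕ

  IsFun : Term → Set
  IsFun (var _)   = ⊥
  IsFun (fun _ _) = ⊤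

  occurs : ℕ → Term → Bool
  occurs x (var y)    = x ≡ᵇ y
  occurs x (fun f ts) = anyFin (ar f) (λ i → occurs x (ts i))

  occ : ℕ → Term → ℕ
  occ x (var y) with x ≡ᵇ y
  ... | true  = 1
  ... | false = 0
  occ x (fun f ts) = sumFin (ar f) (λ i → occ x (ts i))

  Linear : Term → Set
  Linear t = ∀ x → occ x t ≤ 1

  _[_] : Term → (ℕ → Term) → Term
  var x    [ σ ] = σ x
  fun f ts [ σ ] = fun f (λ i → ts i [ σ ])

  record TRule : Set where
    field
      lhs    : Term
      rhs    : Term
      lhs-nonvar : IsFun lhs
      vars⊆  : ∀ x → T (occurs x rhs) → T (occurs x lhs)

  data Ctx : Set where
    hole : Ctx
    node : (f : Sym) (i : Fin (ar f)) (ts : Fin (ar f) → Term) (C : Ctx) → Ctx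
    -- hole below argument i; the other arguments are ts j (j ≠ i)

  upd : ∀ {n} → (Fin n → Term) → Fin n → Term → Fin n → Term
  upd ts i u j with j ≟ i
  ... | yes _ = u
  ... | no  _ = ts j

  plug : Ctx → Term → Term
  plug hole             u = u
  plug (node f i ts C) u = fun f (upd ts i (plug C u))

  holePos : Ctx → Pos
  holePos hole             = []
  holePos (node f i ts C) = suc (toℕ i) ∷ holePos C

  RewStep : TRule → Term → Term → Pos → Set
  RewStep ρ s t p =
    Σ Ctx λ C → Σ (ℕ → Term) λ σ →
      (s ≡ plug C (TRule.lhs ρ [ σ ])) × (t ≡ plug C (TRule.rhs ρ [ σ ])) × (holePos C ≡ p)

  data Lbl : Set where
    bot top : Lbl
    sym : Sym → Lbl
    arg : ℕ → Lbl      -- arg n stands for the positive integer n + 1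

  data _≤L_ : Lbl → Lbl → Set where
    bot≤  : ∀ {a} → bot ≤L a
    ≤top  : ∀ {a} → a ≤L top
    ≤refl : ∀ {a} → a ≤L a

  ≤L-trans : ∀ {a b c} → a ≤L b → b ≤L c → a ≤L c
  ≤L-trans bot≤  q = bot≤
  ≤L-trans ≤top  ≤top = ≤top
  ≤L-trans ≤top  ≤refl = ≤top
  ≤L-trans ≤refl q = q

  record Graph : Set₁ where
    field
      V E : Set
      src tgt : E → V
      ℓV : V → Lbl
      ℓE : E → Lbl
  open Graph public

  record Hom (G H : Graph) : Set where
    field
      fV : V G → V H
      fE : E G → E H
      src-comm : ∀ e → fV (src G e) ≡ src H (fE e)
      tgt-comm : ∀ e → fV (tgt G e) ≡ tgt H (fE e)
      ℓV-mono : ∀ v → ℓV G v ≤L ℓV H (fV v)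
      ℓE-mono : ∀ e → ℓE G e ≤L ℓE H (fE e)
  open Hom public

  idH : (G : Graph) → Hom G G
  idH G = record { fV = λ v → v ; fE = λ e → e ; src-comm = λ _ → refl
                 ; tgt-comm = λ _ → refl ; ℓV-mono = λ _ → ≤refl ; ℓE-mono = λ _ → ≤refl }

  _∘H_ : ∀ {A B C} → Hom B C → Hom A B → Hom A C
  g ∘H f = record
    { fV = λ v → fV g (fV f v)
    ; fE = λ e → fE g (fE f e)
    ; src-comm = λ e → trans (cong (fV g) (src-comm f e)) (src-comm g (fE f e))
    ; tgt-comm = λ e → trans (cong (fV g) (tgt-comm f e)) (tgt-comm g (fE f e))
    ; ℓV-mono = λ v → ≤L-trans (ℓV-mono f v) (ℓV-mono g (fV f v))
    ; ℓE-mono = λ e → ≤L-trans (ℓE-mono f e) (ℓE-mono g (fE f e)) }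

  _≈H_ : ∀ {A B} → Hom A B → Hom A B → Set
  f ≈H g = (∀ v → fV f v ≡ fV g v) × (∀ e → fE f e ≡ fE g e)

  Mono : ∀ {A B} → Hom A B → Set₁
  Mono {A} f = ∀ (Q : Graph) (g h : Hom Q A) → (f ∘H g) ≈H (f ∘H h) → g ≈H h

  IsPullback : ∀ {A B C P} → Hom A C → Hom B C → Hom P A → Hom P B → Set₁
  IsPullback {A} {B} {C} {P} f g p₁ p₂ =
    ((f ∘H p₁) ≈H (g ∘H p₂)) ×
    (∀ (Q : Graph) (q₁ : Hom Q A) (q₂ : Hom Q B) → (f ∘H q₁) ≈H (g ∘H q₂) →
       Σ (Hom Q P) λ h → ((p₁ ∘H h) ≈H q₁) × ((p₂ ∘H h) ≈H q₂) ×
         (∀ (h' : Hom Q P) → (p₁ ∘H h') ≈H q₁ → (p₂ ∘H h') ≈H q₂ → h' ≈H h))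

  IsPushout : ∀ {A B C P} → Hom A B → Hom A C → Hom B P → Hom C P → Set₁
  IsPushout {A} {B} {C} {P} f g i₁ i₂ =
    ((i₁ ∘H f) ≈H (i₂ ∘H g)) ×
    (∀ (Q : Graph) (q₁ : Hom B Q) (q₂ : Hom C Q) → (q₁ ∘H f) ≈H (q₂ ∘H g) →
       Σ (Hom P Q) λ h → ((h ∘H i₁) ≈H q₁) × ((h ∘H i₂) ≈H q₂) ×
         (∀ (h' : Hom P Q) → (h' ∘H i₁) ≈H q₁ → (h' ∘H i₂) ≈H q₂ → h' ≈H h))

  record PRule : Set₁ where
    field
      L K R L' K' : Graph
      l  : Hom K L
      r  : Hom K R
      l' : Hom K' L'
      tL : Hom L L'
      tK : Hom K K'

  record PStep (ρ : PRule) (GL GR : Graph) (P : Hom (PRule.L ρ) GL → Set) : Set₁ where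
    open PRule ρ
    field
      m      : Hom L GL
      m-mono : Mono m
      α      : Hom GL L'
      α∘m≈tL : (α ∘H m) ≈H tL
      L-pb   : IsPullback tL α (idH L) m
      GK     : Graph
      gL     : Hom GK GL
      u'     : Hom GK K'
      K-pb   : IsPullback α l' gL u'
      u      : Hom K GK
      u'∘u   : (u' ∘H u) ≈H tK
      gL∘u   : (gL ∘H u) ≈H (m ∘H l)
      gR     : Hom GK GR
      w      : Hom R GR
      R-po   : IsPushout u r gR w
      match  : P m

  -- Rooted graphs whose vertex set is (ordinary vertices N) ⊎ (variable vertices X)

  record TGraph : Set₁ where
    field
      N X E : Set
      src tgt : E → N ⊎ X
      ℓN : N → Lbl
      ℓE : E → Lbl
      root : N ⊎ X

  ⌊_⌋ : TGraph → Graph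
  ⌊ G ⌋ = record
    { V = TGraph.N G ⊎ TGraph.X G ; E = TGraph.E G
    ; src = TGraph.src G ; tgt = TGraph.tgt G
    ; ℓV = λ { (inj₁ n) → TGraph.ℓN G n ; (inj₂ _) → bot }
    ; ℓE = TGraph.ℓE G }

  -- context closure 𝒞[G↓𝒳]: vertices (N ⊎ X) ⊎ (X' ⊎ {𝒞})
  closure : TGraph → Graph
  closure G = record
    { V = (G.N ⊎ G.X) ⊎ (G.X ⊎ ⊤)
    ; E = G.E ⊎ ((G.X ⊎ G.X) ⊎ (⊤ ⊎ ⊤))
    ; src = λ { (inj₁ e) → inj₁ (G.src e)
              ; (inj₂ (inj₁ (inj₁ x))) → inj₁ (inj₂ x)       -- x → x'
              ; (inj₂ (inj₁ (inj₂ x))) → inj₂ (inj₁ x)       -- x' → x'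
              ; (inj₂ (inj₂ (inj₁ _))) → inj₂ (inj₂ tt)      -- 𝒞 → root
              ; (inj₂ (inj₂ (inj₂ _))) → inj₂ (inj₂ tt) }    -- 𝒞 → 𝒞
    ; tgt = λ { (inj₁ e) → inj₁ (G.tgt e)
              ; (inj₂ (inj₁ (inj₁ x))) → inj₂ (inj₁ x)
              ; (inj₂ (inj₁ (inj₂ x))) → inj₂ (inj₁ x)
              ; (inj₂ (inj₂ (inj₁ _))) → inj₁ G.root
              ; (inj₂ (inj₂ (inj₂ _))) → inj₂ (inj₂ tt) }
    ; ℓV = λ { (inj₁ (inj₁ n)) → G.ℓN n ; (inj₁ (inj₂ _)) → top ; (inj₂ _) → top }
    ; ℓE = λ { (inj₁ e) → G.ℓE e ; (inj₂ _) → top } }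
    where module G = TGraph G

  incl : (G : TGraph) → Hom ⌊ G ⌋ (closure G)
  incl G = record
    { fV = inj₁ ; fE = inj₁ ; src-comm = λ _ → refl ; tgt-comm = λ _ → refl
    ; ℓV-mono = λ { (inj₁ n) → ≤refl ; (inj₂ x) → bot≤ }
    ; ℓE-mono = λ _ → ≤refl }

  FunPos : Term → Set
  FunPos (var x)    = ⊥
  FunPos (fun f ts) = ⊤ ⊎ Σ (Fin (ar f)) (λ i → FunPos (ts i))

  funPos : (t : Term) → FunPos t → Pos
  funPos (fun f ts) (inj₁ _)       = []
  funPos (fun f ts) (inj₂ (i , q)) = suc (toℕ i) ∷ funPos (ts i) q

  symAt : (t : Term) → FunPos t → Sym
  symAt (fun f ts) (inj₁ _)       = f
  symAt (fun f ts) (inj₂ (i , q)) = symAt (ts i) q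

  Vars : Term → Set
  Vars t = Σ ℕ λ x → T (occurs x t)

  Vert : Term → Set
  Vert t = FunPos t ⊎ Vars t

  Edge : Term → Set
  Edge (var x)    = ⊥
  Edge (fun f ts) = Fin (ar f) ⊎ Σ (Fin (ar f)) (λ i → Edge (ts i))

  liftV : (f : Sym) (ts : Fin (ar f) → Term) (i : Fin (ar f)) → Vert (ts i) → Vert (fun f ts)
  liftV f ts i (inj₁ q)        = inj₁ (inj₂ (i , q))
  liftV f ts i (inj₂ (x , pr)) =
    inj₂ (x , anyFin-intro (ar f) (λ j → occurs x (ts j)) i pr)

  rootV : (t : Term) → Vert t
  rootV (var x)    = inj₂ (x , ≡⇒≡ᵇ x x refl)
  rootV (fun f ts) = inj₁ (inj₁ tt)

  srcT tgtT : (t : Term) → Edge t → Vert t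
  srcT (fun f ts) (inj₁ i)       = inj₁ (inj₁ tt)
  srcT (fun f ts) (inj₂ (i , e)) = liftV f ts i (srcT (ts i) e)
  tgtT (fun f ts) (inj₁ i)       = liftV f ts i (rootV (ts i))
  tgtT (fun f ts) (inj₂ (i , e)) = liftV f ts i (tgtT (ts i) e)

  ℓEdge : (t : Term) → Edge t → Lbl
  ℓEdge (fun f ts) (inj₁ i)       = arg (toℕ i)     -- label i+1 (1-based argument index)
  ℓEdge (fun f ts) (inj₂ (i , e)) = ℓEdge (ts i) e

  encT : Term → TGraph
  encT t = record
    { N = FunPos t ; X = Vars t ; E = Edge t
    ; src = srcT t ; tgt = tgtT t
    ; ℓN = λ q → sym (symAt t q) ; ℓE = ℓEdge t ; root = rootV t }

  _° : Term → Graph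
  t ° = ⌊ encT t ⌋

  -- ℐ(r): discrete graph on Var(r) ∪ {ε}, all labelled ⊥, root ε
  encI : Term → TGraph
  encI r = record
    { N = ⊤ ; X = Vars r ; E = ⊥
    ; src = λ () ; tgt = λ ()
    ; ℓN = λ _ → bot ; ℓE = λ () ; root = inj₁ tt }

  module Enc (ρ : TRule) where
    open TRule ρ

    varL : Vars rhs → Vars lhs
    varL (x , pr) = (x , vars⊆ x pr)

    homl : Hom ⌊ encI rhs ⌋ (lhs °)
    homl = record
      { fV = λ { (inj₁ _) → rootV lhs ; (inj₂ x) → inj₂ (varL x) }
      ; fE = λ ()
      ; src-comm = λ () ; tgt-comm = λ ()
      ; ℓV-mono = λ { (inj₁ _) → bot≤ ; (inj₂ _) → bot≤ }
      ; ℓE-mono = λ () }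

    homr : Hom ⌊ encI rhs ⌋ (rhs °)
    homr = record
      { fV = λ { (inj₁ _) → rootV rhs ; (inj₂ x) → inj₂ x }
      ; fE = λ ()
      ; src-comm = λ () ; tgt-comm = λ ()
      ; ℓV-mono = λ { (inj₁ _) → bot≤ ; (inj₂ _) → bot≤ }
      ; ℓE-mono = λ () }

    homl' : Hom (closure (encI rhs)) (closure (encT lhs))
    homl' = record
      { fV = λ { (inj₁ (inj₁ _)) → inj₁ (rootV lhs)
               ; (inj₁ (inj₂ x)) → inj₁ (inj₂ (varL x))
               ; (inj₂ (inj₁ x)) → inj₂ (inj₁ (varL x))
               ; (inj₂ (inj₂ _)) → inj₂ (inj₂ tt) }
      ; fE = λ { (inj₁ ())
               ; (inj₂ (inj₁ (inj₁ x))) → inj₂ (inj₁ (inj₁ (varL x)))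
               ; (inj₂ (inj₁ (inj₂ x))) → inj₂ (inj₁ (inj₂ (varL x)))
               ; (inj₂ (inj₂ c)) → inj₂ (inj₂ c) }
      ; src-comm = λ { (inj₁ ())
                     ; (inj₂ (inj₁ (inj₁ x))) → refl
                     ; (inj₂ (inj₁ (inj₂ x))) → refl
                     ; (inj₂ (inj₂ (inj₁ _))) → refl
                     ; (inj₂ (inj₂ (inj₂ _))) → refl }
      ; tgt-comm = λ { (inj₁ ())
                     ; (inj₂ (inj₁ (inj₁ x))) → refl
                     ; (inj₂ (inj₁ (inj₂ x))) → refl
                     ; (inj₂ (inj₂ (inj₁ _))) → refl
                     ; (inj₂ (inj₂ (inj₂ _))) → refl }
      ; ℓV-mono = λ { (inj₁ (inj₁ _)) → bot≤
                    ; (inj₁ (inj₂ x)) → ≤refl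
                    ; (inj₂ (inj₁ x)) → ≤refl
                    ; (inj₂ (inj₂ _)) → ≤refl }
      ; ℓE-mono = λ { (inj₁ ()) ; (inj₂ (inj₁ (inj₁ x))) → ≤refl
                    ; (inj₂ (inj₁ (inj₂ x))) → ≤refl ; (inj₂ (inj₂ (inj₁ _))) → ≤refl
                    ; (inj₂ (inj₂ (inj₂ _))) → ≤refl } }

    rule° : PRule
    rule° = record
      { L = lhs ° ; K = ⌊ encI rhs ⌋ ; R = rhs °
      ; L' = closure (encT lhs) ; K' = closure (encI rhs)
      ; l = homl ; r = homr ; l' = homl'
      ; tL = incl (encT lhs) ; tK = incl (encI rhs) }

  PStepAt : TRule → Term → Term → Pos → Set₁
  PStepAt ρ s t p =
    PStep (Enc.rule° ρ) (s °) (t °)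
      (λ m → Σ (FunPos s) λ v →
               (funPos s v ≡ p) × (fV m (rootV (TRule.lhs ρ)) ≡ inj₁ v))

module Submission where

-- Write s = C[lσ] and t = C[rσ].  Since s and l are linear, the graph s° splits into
-- three disjoint parts: the context C (with the edge entering the hole), the function
-- positions of l, and one copy of (σ x)° for every variable x of l; likewise for t°
-- with r in place of l.  The match m is the inclusion of the middle part.  The map
-- α : s° → L' collapses the context onto 𝒞 and each copy of σ x onto x' (its root onto
-- x); as only the pattern part lands in l°, the square over L is a pullback.  The
-- pullback GK of α and l' then consists of the context, the root of lσ and the copies
-- of σ x with x ∈ Var(r), and gluing r° to it along K recovers exactly the three parts
-- of t°, which is the required pushout.

open import Defs
open import Axiom.UniquenessOfIdentityProofs.WithK using (uip)
open import Data.Bool using (Bool; true; false; T)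
open import Data.Bool.Properties using (T-irrelevant)
open import Data.Empty using (⊥; ⊥-elim)
open import Data.Fin using (Fin; zero; suc; toℕ; _≟_)
open import Data.List using (_∷_; _++_)
open import Data.List.Properties using (++-identityʳ)
open import Data.Nat using (ℕ; suc; _+_; _≤_; _≡ᵇ_; s≤s)
open import Data.Nat.Properties
  using (≤-trans; ≤-refl; m≤m+n; m≤n+m; +-monoʳ-≤; +-mono-≤; +-comm; ≡ᵇ⇒≡; ≡⇒≡ᵇ)
open import Data.Product using (Σ; _×_; _,_; proj₁; proj₂)
open import Data.Sum using (_⊎_; inj₁; inj₂; [_,_]′)
open import Data.Sum.Properties using (inj₁-injective)
open import Data.Unit using (⊤; tt)
open import Relation.Binary.PropositionalEquality hiding ([_])
open import Relation.Nullary using (yes; no; Dec)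
open import Relation.Nullary.Decidable using (False; fromWitnessFalse; toWitnessFalse)

anyFin-witness : ∀ n (g : Fin n → Bool) → T (anyFin n g) → Σ (Fin n) (λ i → T (g i))
anyFin-witness (suc n) g h with g zero in eq
... | true  = zero , subst T (sym eq) tt
... | false with anyFin-witness n (λ j → g (suc j)) h
...   | i , p = suc i , p

≤-sumFin : ∀ n g (i : Fin n) → g i ≤ sumFin n g
≤-sumFin (suc n) g zero    = m≤m+n _ _
≤-sumFin (suc n) g (suc i) = ≤-trans (≤-sumFin n _ i) (m≤n+m _ _)

+-≤-sumFin : ∀ n g (i j : Fin n) → i ≢ j → g i + g j ≤ sumFin n g
+-≤-sumFin (suc n) g zero    zero    i≢j = ⊥-elim (i≢j refl)
+-≤-sumFin (suc n) g zero    (suc j) i≢j = +-monoʳ-≤ (g zero) (≤-sumFin n _ j)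
+-≤-sumFin (suc n) g (suc i) zero    i≢j =
  subst (_≤ sumFin (suc n) g) (+-comm (g zero) (g (suc i)))
    (+-monoʳ-≤ (g zero) (≤-sumFin n _ i))
+-≤-sumFin (suc n) g (suc i) (suc j) i≢j =
  ≤-trans (+-≤-sumFin n _ i j (λ i≡j → i≢j (cong suc i≡j))) (m≤n+m _ _)

module GraphFacts (𝕊 : Signature) where
  open Sig 𝕊 renaming (sym to symL)

  ≤L-≡ʳ : ∀ {a b c} → a ≤L b → b ≡ c → a ≤L c
  ≤L-≡ʳ a≤b refl = a≤b

  ≤L-≡ˡ : ∀ {a b c} → a ≡ b → b ≤L c → a ≤L c
  ≤L-≡ˡ refl b≤c = b≤c

  injective⇒Mono : ∀ {A B} (f : Hom A B) →
                   (∀ a b → fV f a ≡ fV f b → a ≡ b) →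
                   (∀ a b → fE f a ≡ fE f b → a ≡ b) → Mono f
  injective⇒Mono f injV injE Q g h (gh-V , gh-E) =
    (λ v → injV _ _ (gh-V v)) , (λ e → injE _ _ (gh-E e))

  reflecting⇒IsPullback-id : ∀ {L L' G} (tL : Hom L L') (α : Hom G L') (m : Hom L G) →
    (α ∘H m) ≈H tL →
    (∀ v a → fV α v ≡ fV tL a → fV m a ≡ v) →
    (∀ e a → fE α e ≡ fE tL a → fE m a ≡ e) →
    IsPullback tL α (idH L) m
  reflecting⇒IsPullback-id tL α m (αm-V , αm-E) reflectV reflectE =
    ((λ v → sym (αm-V v)) , (λ e → sym (αm-E e))) ,
    λ Q q₁ q₂ (q-V , q-E) →
      q₁ , ((λ _ → refl) , (λ _ → refl)) ,
      ((λ x → reflectV (fV q₂ x) (fV q₁ x) (sym (q-V x))) ,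
       (λ x → reflectE (fE q₂ x) (fE q₁ x) (sym (q-E x)))) ,
      λ h' (h'-V , h'-E) _ → h'-V , h'-E

  -- Pullbacks in Graph(Σ°) are computed pointwise, labelling each pair by a meet.
  module CanonicalPullback {A B C : Graph} (f : Hom A C) (g : Hom B C)
    (meetV : V A → V B → Lbl) (meetE : E A → E B → Lbl)
    (meetV-≤ˡ : ∀ a b → meetV a b ≤L ℓV A a) (meetV-≤ʳ : ∀ a b → meetV a b ≤L ℓV B b)
    (meetV-greatest : ∀ a b c → c ≤L ℓV A a → c ≤L ℓV B b → c ≤L meetV a b)
    (meetE-≤ˡ : ∀ a b → meetE a b ≤L ℓE A a) (meetE-≤ʳ : ∀ a b → meetE a b ≤L ℓE B b)
    (meetE-greatest : ∀ a b c → c ≤L ℓE A a → c ≤L ℓE B b → c ≤L meetE a b) where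

    PbV : Set
    PbV = Σ (V A) λ a → Σ (V B) λ b → fV f a ≡ fV g b

    PbE : Set
    PbE = Σ (E A) λ a → Σ (E B) λ b → fE f a ≡ fE g b

    Pb-≡ : ∀ {X Y Z : Set} {h : X → Z} {k : Y → Z} {a a' : X} {b b' : Y}
           {q : h a ≡ k b} {q' : h a' ≡ k b'} → a ≡ a' → b ≡ b' →
           _≡_ {A = Σ X λ a → Σ Y λ b → h a ≡ k b} (a , b , q) (a' , b' , q')
    Pb-≡ {a = a} {b = b} {q = q} {q' = q'} refl refl = cong (λ z → a , b , z) (uip q q')

    P : Graph
    P = record
      { V = PbV ; E = PbE
      ; src = λ { (a , b , q) → src A a , src B b ,
                   trans (src-comm f a) (trans (cong (src C) q) (sym (src-comm g b))) }
      ; tgt = λ { (a , b , q) → tgt A a , tgt B b ,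
                   trans (tgt-comm f a) (trans (cong (tgt C) q) (sym (tgt-comm g b))) }
      ; ℓV = λ { (a , b , _) → meetV a b }
      ; ℓE = λ { (a , b , _) → meetE a b } }

    p₁ : Hom P A
    p₁ = record
      { fV = proj₁ ; fE = proj₁ ; src-comm = λ _ → refl ; tgt-comm = λ _ → refl
      ; ℓV-mono = λ { (a , b , _) → meetV-≤ˡ a b } ; ℓE-mono = λ { (a , b , _) → meetE-≤ˡ a b } }

    p₂ : Hom P B
    p₂ = record
      { fV = λ x → proj₁ (proj₂ x) ; fE = λ x → proj₁ (proj₂ x)
      ; src-comm = λ _ → refl ; tgt-comm = λ _ → refl
      ; ℓV-mono = λ { (a , b , _) → meetV-≤ʳ a b } ; ℓE-mono = λ { (a , b , _) → meetE-≤ʳ a b } }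

    pairing : ∀ {Q} (q₁ : Hom Q A) (q₂ : Hom Q B) → (f ∘H q₁) ≈H (g ∘H q₂) → Hom Q P
    pairing q₁ q₂ (q-V , q-E) = record
      { fV = λ x → fV q₁ x , fV q₂ x , q-V x
      ; fE = λ x → fE q₁ x , fE q₂ x , q-E x
      ; src-comm = λ e → Pb-≡ (src-comm q₁ e) (src-comm q₂ e)
      ; tgt-comm = λ e → Pb-≡ (tgt-comm q₁ e) (tgt-comm q₂ e)
      ; ℓV-mono = λ x → meetV-greatest _ _ _ (ℓV-mono q₁ x) (ℓV-mono q₂ x)
      ; ℓE-mono = λ x → meetE-greatest _ _ _ (ℓE-mono q₁ x) (ℓE-mono q₂ x) }

    isPullback : IsPullback f g p₁ p₂
    isPullback = ((λ { (a , b , q) → q }) , (λ { (a , b , q) → q })) ,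
      λ Q q₁ q₂ q≈ →
        pairing q₁ q₂ q≈ , ((λ _ → refl) , (λ _ → refl)) , ((λ _ → refl) , (λ _ → refl)) ,
        λ h' (h₁-V , h₁-E) (h₂-V , h₂-E) →
          (λ x → Pb-≡ (h₁-V x) (h₂-V x)) , (λ x → Pb-≡ (h₁-E x) (h₂-E x))

  -- A pushout criterion: every element of P is recovered (splitV, splitE) from G or R,
  -- and splitting an element in the image of g or w lands, up to the identifications
  -- u k ~ r k made by any cocone, on the element it came from.
  module PushoutBySplitting {K G R P : Graph}
    (u : Hom K G) (r : Hom K R) (g : Hom G P) (w : Hom R P)
    (comm : (g ∘H u) ≈H (w ∘H r))
    (splitV : V P → V G ⊎ V R) (splitE : E P → E G ⊎ E R)
    (splitV-section : ∀ v → [ fV g , fV w ]′ (splitV v) ≡ v)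
    (splitE-section : ∀ e → [ fE g , fE w ]′ (splitE e) ≡ e)
    (splitV-ℓ : ∀ v → ℓV P v ≤L [ ℓV G , ℓV R ]′ (splitV v))
    (splitE-ℓ : ∀ e → ℓE P e ≤L [ ℓE G , ℓE R ]′ (splitE e))
    (splitV-g : ∀ a → (splitV (fV g a) ≡ inj₁ a)
                    ⊎ (Σ (V K) λ k → Σ (V K) λ k' →
                         (a ≡ fV u k) × (splitV (fV g a) ≡ inj₁ (fV u k')) × (fV r k ≡ fV r k'))
                    ⊎ (Σ (V K) λ k → (a ≡ fV u k) × (splitV (fV g a) ≡ inj₂ (fV r k))))
    (splitV-w : ∀ b → (splitV (fV w b) ≡ inj₂ b)
                    ⊎ (Σ (V K) λ k' → (splitV (fV w b) ≡ inj₁ (fV u k')) × (fV r k' ≡ b)))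
    (splitE-g : ∀ e → splitE (fE g e) ≡ inj₁ e)
    (splitE-w : ∀ e → splitE (fE w e) ≡ inj₂ e) where

    module Mediator (Q : Graph) (q₁ : Hom G Q) (q₂ : Hom R Q) (qc : (q₁ ∘H u) ≈H (q₂ ∘H r)) where
      medV : V P → V Q
      medV v = [ fV q₁ , fV q₂ ]′ (splitV v)

      medE : E P → E Q
      medE e = [ fE q₁ , fE q₂ ]′ (splitE e)

      medV-g : ∀ a → medV (fV g a) ≡ fV q₁ a
      medV-g a with splitV-g a
      ... | inj₁ eq = cong [ fV q₁ , fV q₂ ]′ eq
      ... | inj₂ (inj₁ (k , k' , refl , eq , rk≡rk')) =
        trans (cong [ fV q₁ , fV q₂ ]′ eq)
          (trans (proj₁ qc k') (trans (cong (fV q₂) (sym rk≡rk')) (sym (proj₁ qc k))))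
      ... | inj₂ (inj₂ (k , refl , eq)) =
        trans (cong [ fV q₁ , fV q₂ ]′ eq) (sym (proj₁ qc k))

      medV-w : ∀ b → medV (fV w b) ≡ fV q₂ b
      medV-w b with splitV-w b
      ... | inj₁ eq = cong [ fV q₁ , fV q₂ ]′ eq
      ... | inj₂ (k' , eq , refl) = trans (cong [ fV q₁ , fV q₂ ]′ eq) (proj₁ qc k')

      medE-g : ∀ e → medE (fE g e) ≡ fE q₁ e
      medE-g e = cong [ fE q₁ , fE q₂ ]′ (splitE-g e)

      medE-w : ∀ e → medE (fE w e) ≡ fE q₂ e
      medE-w e = cong [ fE q₁ , fE q₂ ]′ (splitE-w e)

      med-end : (end : (H : Graph) → E H → V H) →
                (∀ {H H'} (h : Hom H H') e → fV h (end H e) ≡ end H' (fE h e)) →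
                ∀ e → medV (end P e) ≡ end Q (medE e)
      med-end end end-comm e = by-split (splitE e) (splitE-section e)
        where
        open ≡-Reasoning
        by-split : ∀ c → [ fE g , fE w ]′ c ≡ e → medV (end P e) ≡ end Q (medE e)
        by-split (inj₁ x) refl = begin
          medV (end P (fE g x))  ≡⟨ cong medV (sym (end-comm g x)) ⟩
          medV (fV g (end G x))  ≡⟨ medV-g (end G x) ⟩
          fV q₁ (end G x)        ≡⟨ end-comm q₁ x ⟩
          end Q (fE q₁ x)        ≡⟨ cong (end Q) (sym (medE-g x)) ⟩
          end Q (medE (fE g x))  ∎
        by-split (inj₂ x) refl = begin
          medV (end P (fE w x))  ≡⟨ cong medV (sym (end-comm w x)) ⟩
          medV (fV w (end R x))  ≡⟨ medV-w (end R x) ⟩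
          fV q₂ (end R x)        ≡⟨ end-comm q₂ x ⟩
          end Q (fE q₂ x)        ≡⟨ cong (end Q) (sym (medE-w x)) ⟩
          end Q (medE (fE w x))  ∎

      med-ℓV : ∀ v → ℓV P v ≤L ℓV Q (medV v)
      med-ℓV v = by-split (splitV v) (splitV-ℓ v)
        where
        by-split : ∀ c → ℓV P v ≤L [ ℓV G , ℓV R ]′ c → ℓV P v ≤L ℓV Q ([ fV q₁ , fV q₂ ]′ c)
        by-split (inj₁ x) ≤ℓ = ≤L-trans ≤ℓ (ℓV-mono q₁ x)
        by-split (inj₂ x) ≤ℓ = ≤L-trans ≤ℓ (ℓV-mono q₂ x)

      med-ℓE : ∀ e → ℓE P e ≤L ℓE Q (medE e)
      med-ℓE e = by-split (splitE e) (splitE-ℓ e)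
        where
        by-split : ∀ c → ℓE P e ≤L [ ℓE G , ℓE R ]′ c → ℓE P e ≤L ℓE Q ([ fE q₁ , fE q₂ ]′ c)
        by-split (inj₁ x) ≤ℓ = ≤L-trans ≤ℓ (ℓE-mono q₁ x)
        by-split (inj₂ x) ≤ℓ = ≤L-trans ≤ℓ (ℓE-mono q₂ x)

      mediator : Hom P Q
      mediator = record
        { fV = medV ; fE = medE
        ; src-comm = med-end src src-comm
        ; tgt-comm = med-end tgt tgt-comm
        ; ℓV-mono = med-ℓV ; ℓE-mono = med-ℓE }

      mediator-unique : ∀ (h' : Hom P Q) → (h' ∘H g) ≈H q₁ → (h' ∘H w) ≈H q₂ → h' ≈H mediator
      mediator-unique h' (hg-V , hg-E) (hw-V , hw-E) =
        (λ v → onV v (splitV v) (splitV-section v)) , (λ e → onE e (splitE e) (splitE-section e))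
        where
        onV : ∀ v c → [ fV g , fV w ]′ c ≡ v → fV h' v ≡ medV v
        onV v (inj₁ x) refl = trans (hg-V x) (sym (medV-g x))
        onV v (inj₂ x) refl = trans (hw-V x) (sym (medV-w x))
        onE : ∀ e c → [ fE g , fE w ]′ c ≡ e → fE h' e ≡ medE e
        onE e (inj₁ x) refl = trans (hg-E x) (sym (medE-g x))
        onE e (inj₂ x) refl = trans (hw-E x) (sym (medE-w x))

    isPushout : IsPushout u r g w
    isPushout = comm , λ Q q₁ q₂ qc → let open Mediator Q q₁ q₂ qc in
      mediator , (medV-g , medE-g) , (medV-w , medE-w) , mediator-unique

module TermGraphFacts (𝕊 : Signature) where
  open Signature 𝕊
  open Sig 𝕊 renaming (sym to symL)

  occurs⇒1≤occ : ∀ x t → T (occurs x t) → 1 ≤ occ x t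
  occurs⇒1≤occ x (var y) h with x ≡ᵇ y
  ... | true = ≤-refl
  occurs⇒1≤occ x (fun f ts) h with anyFin-witness (ar f) (λ j → occurs x (ts j)) h
  ... | i , p = ≤-trans (occurs⇒1≤occ x (ts i) p) (≤-sumFin _ _ i)

  Linear-arg : ∀ f ts → Linear (fun f ts) → ∀ i → Linear (ts i)
  Linear-arg f ts lin i x = ≤-trans (≤-sumFin _ (λ j → occ x (ts j)) i) (lin x)

  Linear-occurs-unique : ∀ f ts → Linear (fun f ts) → ∀ x i i' →
                         T (occurs x (ts i)) → T (occurs x (ts i')) → i' ≡ i
  Linear-occurs-unique f ts lin x i i' p q with i' ≟ i
  ... | yes i'≡i = i'≡i
  ... | no  i'≢i with ≤-trans (+-mono-≤ (occurs⇒1≤occ x (ts i') q) (occurs⇒1≤occ x (ts i) p))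
                             (≤-trans (+-≤-sumFin _ (λ j → occ x (ts j)) i' i i'≢i) (lin x))
  ...   | s≤s ()

  Linear-witness-unique : ∀ f ts → Linear (fun f ts) → ∀ x i (p : T (occurs x (ts i)))
                          (z : Σ (Fin (ar f)) λ j → T (occurs x (ts j))) → z ≡ (i , p)
  Linear-witness-unique f ts lin x i p (i' , q) with Linear-occurs-unique f ts lin x i i' p q
  ... | refl = cong (i ,_) (T-irrelevant q p)

  Vars-≡ : ∀ {t} {x : ℕ} (p q : T (occurs x t)) → _≡_ {A = Vars t} (x , p) (x , q)
  Vars-≡ {t} {x} p q = cong (x ,_) (T-irrelevant p q)

  Vars-fun-to : ∀ f ts → Σ (Fin (ar f)) (λ i → Vars (ts i)) → Vars (fun f ts)
  Vars-fun-to f ts (i , x , p) = x , anyFin-intro (ar f) (λ j → occurs x (ts j)) i p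

  Vars-fun-from : ∀ f ts → Vars (fun f ts) → Σ (Fin (ar f)) (λ i → Vars (ts i))
  Vars-fun-from f ts (x , p) with anyFin-witness (ar f) (λ j → occurs x (ts j)) p
  ... | i , q = i , x , q

  Vars-fun-to-from : ∀ f ts v → Vars-fun-to f ts (Vars-fun-from f ts v) ≡ v
  Vars-fun-to-from f ts (x , p) = Vars-≡ {fun f ts} _ _

  Vars-fun-from-to : ∀ f ts → Linear (fun f ts) → ∀ w → Vars-fun-from f ts (Vars-fun-to f ts w) ≡ w
  Vars-fun-from-to f ts lin (i , x , p)
    with anyFin-witness _ (λ j → occurs x (ts j)) (anyFin-intro (ar f) (λ j → occurs x (ts j)) i p)
       | Linear-witness-unique f ts lin x i p
  ... | z | z≡ip rewrite z≡ip z = refl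

  Layer : ∀ f (ts : Fin (ar f) → Term) → Set
  Layer f ts = ⊤ ⊎ Σ (Fin (ar f)) (λ i → Vert (ts i))

  layer-to : ∀ f ts → Layer f ts → Vert (fun f ts)
  layer-to f ts (inj₁ _)       = inj₁ (inj₁ tt)
  layer-to f ts (inj₂ (i , v)) = liftV f ts i v

  layer-from : ∀ f ts → Vert (fun f ts) → Layer f ts
  layer-from f ts (inj₁ (inj₁ _))       = inj₁ tt
  layer-from f ts (inj₁ (inj₂ (i , q))) = inj₂ (i , inj₁ q)
  layer-from f ts (inj₂ x) = varLayer (Vars-fun-from f ts x)
    where varLayer : Σ (Fin (ar f)) (λ i → Vars (ts i)) → Layer f ts
          varLayer (i , y) = inj₂ (i , inj₂ y)

  layer-to-from : ∀ f ts v → layer-to f ts (layer-from f ts v) ≡ v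
  layer-to-from f ts (inj₁ (inj₁ _))       = refl
  layer-to-from f ts (inj₁ (inj₂ (i , q))) = refl
  layer-to-from f ts (inj₂ x) = cong inj₂ (Vars-fun-to-from f ts x)

  layer-from-to : ∀ f ts → Linear (fun f ts) → ∀ a → layer-from f ts (layer-to f ts a) ≡ a
  layer-from-to f ts lin (inj₁ _)             = refl
  layer-from-to f ts lin (inj₂ (i , inj₁ q))  = refl
  layer-from-to f ts lin (inj₂ (i , inj₂ y)) =
    cong (λ { (j , z) → inj₂ (j , inj₂ z) }) (Vars-fun-from-to f ts lin (i , y))

  ℓV-liftV : ∀ f ts i v → ℓV (fun f ts °) (liftV f ts i v) ≡ ℓV (ts i °) v
  ℓV-liftV f ts i (inj₁ q) = refl
  ℓV-liftV f ts i (inj₂ y) = refl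

  castV : ∀ {a b} → a ≡ b → Vert a → Vert b
  castV = subst Vert

  castE : ∀ {a b} → a ≡ b → Edge a → Edge b
  castE = subst Edge

  castV-cancel : ∀ {a b} (p : a ≡ b) (q : b ≡ a) v → castV q (castV p v) ≡ v
  castV-cancel refl refl v = refl

  castE-cancel : ∀ {a b} (p : a ≡ b) (q : b ≡ a) e → castE q (castE p e) ≡ e
  castE-cancel refl refl e = refl

  castV-refl : ∀ {a} (p : a ≡ a) v → castV p v ≡ v
  castV-refl refl v = refl

  castE-refl : ∀ {a} (p : a ≡ a) e → castE p e ≡ e
  castE-refl refl e = refl

  src-castE : ∀ {a b} (p : a ≡ b) e → srcT b (castE p e) ≡ castV p (srcT a e)
  src-castE refl e = refl

  tgt-castE : ∀ {a b} (p : a ≡ b) e → tgtT b (castE p e) ≡ castV p (tgtT a e)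
  tgt-castE refl e = refl

  rootV-castV : ∀ {a b} (p : a ≡ b) → rootV b ≡ castV p (rootV a)
  rootV-castV refl = refl

  ℓV-castV : ∀ {a b} (p : a ≡ b) v → ℓV (b °) (castV p v) ≡ ℓV (a °) v
  ℓV-castV refl v = refl

  ℓE-castE : ∀ {a b} (p : a ≡ b) e → ℓEdge b (castE p e) ≡ ℓEdge a e
  ℓE-castE refl e = refl

  funPos-castV : ∀ {a b} (p : a ≡ b) q →
                 Σ (FunPos b) λ q' → (castV p (inj₁ q) ≡ inj₁ q') × (funPos b q' ≡ funPos a q)
  funPos-castV refl q = q , refl , refl

  Distinct : ∀ {n} → Fin n → Fin n → Set
  Distinct j i = False (j ≟ i)

  upd-at : ∀ {n} (ts : Fin n → Term) i u → upd ts i u i ≡ u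
  upd-at ts i u with i ≟ i
  ... | yes _   = refl
  ... | no  i≢i = ⊥-elim (i≢i refl)

  upd-away : ∀ {n} (ts : Fin n → Term) i u j → Distinct j i → upd ts i u j ≡ ts j
  upd-away ts i u j j≢i with j ≟ i
  ... | no _ = refl

  Linear-plug-node : ∀ f i ts C w → Linear (plug (node f i ts C) w) → Linear (plug C w)
  Linear-plug-node f i ts C w lin =
    subst Linear (upd-at ts i (plug C w)) (Linear-arg f (upd ts i (plug C w)) lin i)

  Linear-plugged : ∀ C w → Linear (plug C w) → Linear w
  Linear-plugged hole            w lin = lin
  Linear-plugged (node f i ts C) w lin = Linear-plugged C w (Linear-plug-node f i ts C w lin)

  isRoot : (w : Term) → Vert w → Bool
  isRoot (var x)    v               = true
  isRoot (fun f ts) (inj₁ (inj₁ _)) = true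
  isRoot (fun f ts) (inj₁ (inj₂ _)) = false
  isRoot (fun f ts) (inj₂ _)        = false

  isTop : (w : Term) → Edge w → Bool
  isTop (fun f ts) (inj₁ _) = true
  isTop (fun f ts) (inj₂ _) = false

  isRoot-rootV : ∀ w → isRoot w (rootV w) ≡ true
  isRoot-rootV (var x)    = refl
  isRoot-rootV (fun f ts) = refl

  isRoot⇒rootV : ∀ w v → isRoot w v ≡ true → v ≡ rootV w
  isRoot⇒rootV (var y) (inj₂ (x , p)) _ with ≡ᵇ⇒≡ x y p
  ... | refl = cong (λ z → inj₂ (x , z)) (T-irrelevant p _)
  isRoot⇒rootV (fun f ts) (inj₁ (inj₁ tt)) _ = refl

  isRoot-liftV : ∀ f ts i v → isRoot (fun f ts) (liftV f ts i v) ≡ false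
  isRoot-liftV f ts i (inj₁ q) = refl
  isRoot-liftV f ts i (inj₂ y) = refl

  isRoot-src : ∀ w e → isRoot w (srcT w e) ≡ isTop w e
  isRoot-src (fun f ts) (inj₁ i)       = refl
  isRoot-src (fun f ts) (inj₂ (i , e)) = isRoot-liftV f ts i _

  isRoot-tgt : ∀ w e → isRoot w (tgtT w e) ≡ false
  isRoot-tgt (fun f ts) (inj₁ i)       = isRoot-liftV f ts i _
  isRoot-tgt (fun f ts) (inj₂ (i , e)) = isRoot-liftV f ts i _

-- The vertices of C[w]° are those of w plus the context vertices: one per node on the
-- path to the hole and those of the sibling subterms hanging off it.  Its edges are
-- those of w, the context edges, and (for C ≠ hole) the edge entering the hole.
module PlugDecomposition (𝕊 : Signature) where
  open Signature 𝕊
  open Sig 𝕊 renaming (sym to symL)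
  open TermGraphFacts 𝕊

  Sibling : (f : Sym) → Fin (ar f) → Set
  Sibling f i = Σ (Fin (ar f)) λ j → Distinct j i

  SiblingV SiblingE : (f : Sym) → Fin (ar f) → (Fin (ar f) → Term) → Set
  SiblingV f i ts = Σ (Fin (ar f)) λ j → Distinct j i × Vert (ts j)
  SiblingE f i ts = Σ (Fin (ar f)) λ j → Distinct j i × Edge (ts j)

  NonHole : Ctx → Set
  NonHole hole           = ⊥
  NonHole (node _ _ _ _) = ⊤

  CtxV CtxE : Ctx → Set
  CtxV hole            = ⊥
  CtxV (node f i ts C) = ⊤ ⊎ (SiblingV f i ts ⊎ CtxV C)
  CtxE hole            = ⊥
  CtxE (node f i ts C) = Sibling f i ⊎ (NonHole C ⊎ (SiblingE f i ts ⊎ CtxE C))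

  PlugV PlugE : Ctx → Term → Set
  PlugV C w = CtxV C ⊎ Vert w
  PlugE C w = (CtxE C ⊎ NonHole C) ⊎ Edge w

  module _ (f : Sym) (i : Fin (ar f)) (ts : Fin (ar f) → Term) (C : Ctx) (w : Term) where
    hole-arg : upd ts i (plug C w) i ≡ plug C w
    hole-arg = upd-at ts i (plug C w)

    sibling-arg : ∀ j → Distinct j i → upd ts i (plug C w) j ≡ ts j
    sibling-arg j j≢i = upd-away ts i (plug C w) j j≢i

  toPlugV : ∀ C w → PlugV C w → Vert (plug C w)
  toPlugV hole            w (inj₂ v)                            = v
  toPlugV (node f i ts C) w (inj₁ (inj₁ _))                     = inj₁ (inj₁ tt)
  toPlugV (node f i ts C) w (inj₁ (inj₂ (inj₁ (j , j≢i , x)))) =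
    liftV f (upd ts i (plug C w)) j (castV (sym (sibling-arg f i ts C w j j≢i)) x)
  toPlugV (node f i ts C) w (inj₁ (inj₂ (inj₂ c))) =
    liftV f (upd ts i (plug C w)) i (castV (sym (hole-arg f i ts C w)) (toPlugV C w (inj₁ c)))
  toPlugV (node f i ts C) w (inj₂ v) =
    liftV f (upd ts i (plug C w)) i (castV (sym (hole-arg f i ts C w)) (toPlugV C w (inj₂ v)))

  deeperV : ∀ f i ts C w → PlugV C w → PlugV (node f i ts C) w
  deeperV f i ts C w (inj₁ c) = inj₁ (inj₂ (inj₂ c))
  deeperV f i ts C w (inj₂ v) = inj₂ v

  toPlugV-deeperV : ∀ f i ts C w a → toPlugV (node f i ts C) w (deeperV f i ts C w a) ≡
                    liftV f (upd ts i (plug C w)) i (castV (sym (hole-arg f i ts C w)) (toPlugV C w a))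
  toPlugV-deeperV f i ts C w (inj₁ c) = refl
  toPlugV-deeperV f i ts C w (inj₂ v) = refl

  fromPlugV : ∀ C w → Vert (plug C w) → PlugV C w
  fromPlugV-arg : ∀ f i ts C w j → Dec (j ≡ i) → Vert (upd ts i (plug C w) j) → PlugV (node f i ts C) w
  fromPlugV-layer : ∀ f i ts C w → Layer f (upd ts i (plug C w)) → PlugV (node f i ts C) w

  fromPlugV hole            w v = inj₂ v
  fromPlugV (node f i ts C) w v = fromPlugV-layer f i ts C w (layer-from f (upd ts i (plug C w)) v)
  fromPlugV-layer f i ts C w (inj₁ _)       = inj₁ (inj₁ tt)
  fromPlugV-layer f i ts C w (inj₂ (j , x)) = fromPlugV-arg f i ts C w j (j ≟ i) x
  fromPlugV-arg f i ts C w j (no j≢i) x =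
    inj₁ (inj₂ (inj₁ (j , fromWitnessFalse j≢i , castV (sibling-arg f i ts C w j (fromWitnessFalse j≢i)) x)))
  fromPlugV-arg f i ts C w .i (yes refl) x =
    deeperV f i ts C w (fromPlugV C w (castV (hole-arg f i ts C w) x))

  fromPlugV-arg-hole : ∀ f i ts C w d x →
    fromPlugV-arg f i ts C w i d (castV (sym (hole-arg f i ts C w)) x) ≡ deeperV f i ts C w (fromPlugV C w x)
  fromPlugV-arg-hole f i ts C w (yes refl) x =
    cong (λ y → deeperV f i ts C w (fromPlugV C w y)) (castV-cancel (sym (hole-arg f i ts C w)) (hole-arg f i ts C w) x)
  fromPlugV-arg-hole f i ts C w (no i≢i) x = ⊥-elim (i≢i refl)

  fromPlugV-arg-sibling : ∀ f i ts C w j j≢i d x →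
    fromPlugV-arg f i ts C w j d (castV (sym (sibling-arg f i ts C w j j≢i)) x) ≡ inj₁ (inj₂ (inj₁ (j , j≢i , x)))
  fromPlugV-arg-sibling f i ts C w j j≢i (yes refl) x = ⊥-elim (toWitnessFalse j≢i refl)
  fromPlugV-arg-sibling f i ts C w j j≢i (no _) x =
    cong₂ (λ a b → inj₁ (inj₂ (inj₁ (j , a , b)))) (T-irrelevant _ _)
      (castV-cancel (sym (sibling-arg f i ts C w j j≢i)) (sibling-arg f i ts C w j (fromWitnessFalse (toWitnessFalse j≢i))) x)

  toPlugV-from : ∀ C w v → toPlugV C w (fromPlugV C w v) ≡ v
  toPlugV-fromPlugV-arg : ∀ f i ts C w j d x →
    toPlugV (node f i ts C) w (fromPlugV-arg f i ts C w j d x) ≡ liftV f (upd ts i (plug C w)) j x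
  toPlugV-from hole            w v = refl
  toPlugV-from (node f i ts C) w v =
    trans (fromLayer (layer-from f (upd ts i (plug C w)) v)) (layer-to-from f _ v)
    where
    fromLayer : ∀ a → toPlugV (node f i ts C) w (fromPlugV-layer f i ts C w a) ≡ layer-to f _ a
    fromLayer (inj₁ _)       = refl
    fromLayer (inj₂ (j , x)) = toPlugV-fromPlugV-arg f i ts C w j (j ≟ i) x
  toPlugV-fromPlugV-arg f i ts C w j (no j≢i) x =
    cong (liftV f _ j) (castV-cancel (sibling-arg f i ts C w j (fromWitnessFalse j≢i))
                                     (sym (sibling-arg f i ts C w j (fromWitnessFalse j≢i))) x)
  toPlugV-fromPlugV-arg f i ts C w .i (yes refl) x = trans (toPlugV-deeperV f i ts C w _)
    (cong (liftV f _ i) (trans (cong (castV (sym (hole-arg f i ts C w))) (toPlugV-from C w _))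
                               (castV-cancel (hole-arg f i ts C w) (sym (hole-arg f i ts C w)) x)))

  fromPlugV-to : ∀ C w → Linear (plug C w) → ∀ a → fromPlugV C w (toPlugV C w a) ≡ a
  fromPlugV-to-deeperV : ∀ f i ts C w → Linear (plug (node f i ts C) w) → ∀ a →
    fromPlugV (node f i ts C) w (toPlugV (node f i ts C) w (deeperV f i ts C w a)) ≡ deeperV f i ts C w a
  fromPlugV-to hole            w lin (inj₂ v)        = refl
  fromPlugV-to (node f i ts C) w lin (inj₁ (inj₁ tt)) = refl
  fromPlugV-to (node f i ts C) w lin (inj₁ (inj₂ (inj₁ (j , j≢i , x)))) =
    trans (cong (fromPlugV-layer f i ts C w) (layer-from-to f _ lin (inj₂ (j , _))))
          (fromPlugV-arg-sibling f i ts C w j j≢i (j ≟ i) x)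
  fromPlugV-to (node f i ts C) w lin (inj₁ (inj₂ (inj₂ c))) = fromPlugV-to-deeperV f i ts C w lin (inj₁ c)
  fromPlugV-to (node f i ts C) w lin (inj₂ v)               = fromPlugV-to-deeperV f i ts C w lin (inj₂ v)
  fromPlugV-to-deeperV f i ts C w lin a = begin
    fromPlugV (node f i ts C) w (toPlugV (node f i ts C) w (deeperV f i ts C w a))
      ≡⟨ cong (fromPlugV (node f i ts C) w) (toPlugV-deeperV f i ts C w a) ⟩
    fromPlugV-layer f i ts C w (layer-from f _ (layer-to f _ (inj₂ (i , castV (sym (hole-arg f i ts C w)) (toPlugV C w a)))))
      ≡⟨ cong (fromPlugV-layer f i ts C w) (layer-from-to f _ lin (inj₂ (i , _))) ⟩
    fromPlugV-arg f i ts C w i (i ≟ i) (castV (sym (hole-arg f i ts C w)) (toPlugV C w a))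
      ≡⟨ fromPlugV-arg-hole f i ts C w (i ≟ i) _ ⟩
    deeperV f i ts C w (fromPlugV C w (toPlugV C w a))
      ≡⟨ cong (deeperV f i ts C w) (fromPlugV-to C w (Linear-plug-node f i ts C w lin) a) ⟩
    deeperV f i ts C w a ∎
    where open ≡-Reasoning

  toPlugE : ∀ C w → PlugE C w → Edge (plug C w)
  toPlugE hole            w (inj₁ (inj₁ ()))
  toPlugE hole            w (inj₁ (inj₂ ()))
  toPlugE hole            w (inj₂ e)                                      = e
  toPlugE (node f i ts C) w (inj₁ (inj₁ (inj₁ (j , j≢i))))                = inj₁ j
  toPlugE (node f i ts C) w (inj₁ (inj₁ (inj₂ (inj₁ _))))                 = inj₁ i
  toPlugE (node f i ts C) w (inj₁ (inj₁ (inj₂ (inj₂ (inj₁ (j , j≢i , e)))))) =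
    inj₂ (j , castE (sym (sibling-arg f i ts C w j j≢i)) e)
  toPlugE (node f i ts C) w (inj₁ (inj₁ (inj₂ (inj₂ (inj₂ c))))) =
    inj₂ (i , castE (sym (hole-arg f i ts C w)) (toPlugE C w (inj₁ (inj₁ c))))
  toPlugE (node f i ts hole) w (inj₁ (inj₂ tt)) = inj₁ i
  toPlugE (node f i ts C@(node _ _ _ _)) w (inj₁ (inj₂ tt)) =
    inj₂ (i , castE (sym (hole-arg f i ts C w)) (toPlugE C w (inj₁ (inj₂ tt))))
  toPlugE (node f i ts C) w (inj₂ e) =
    inj₂ (i , castE (sym (hole-arg f i ts C w)) (toPlugE C w (inj₂ e)))

  deeperE : ∀ f i ts C w → PlugE C w → PlugE (node f i ts C) w
  deeperE f i ts C w (inj₁ (inj₁ c)) = inj₁ (inj₁ (inj₂ (inj₂ (inj₂ c))))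
  deeperE f i ts C w (inj₁ (inj₂ _)) = inj₁ (inj₂ tt)
  deeperE f i ts C w (inj₂ e)        = inj₂ e

  toPlugE-deeperE : ∀ f i ts C w a → toPlugE (node f i ts C) w (deeperE f i ts C w a) ≡
                    inj₂ (i , castE (sym (hole-arg f i ts C w)) (toPlugE C w a))
  toPlugE-deeperE f i ts C              w (inj₁ (inj₁ c)) = refl
  toPlugE-deeperE f i ts (node _ _ _ _) w (inj₁ (inj₂ _)) = refl
  toPlugE-deeperE f i ts C              w (inj₂ e)        = refl

  holeEdge : ∀ f i ts C w → PlugE (node f i ts C) w
  holeEdge f i ts hole           w = inj₁ (inj₂ tt)
  holeEdge f i ts (node _ _ _ _) w = inj₁ (inj₁ (inj₂ (inj₁ tt)))

  toPlugE-holeEdge : ∀ f i ts C w → toPlugE (node f i ts C) w (holeEdge f i ts C w) ≡ inj₁ i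
  toPlugE-holeEdge f i ts hole           w = refl
  toPlugE-holeEdge f i ts (node _ _ _ _) w = refl

  fromPlugE : ∀ C w → Edge (plug C w) → PlugE C w
  fromPlugE-top : ∀ f i ts C w j → Dec (j ≡ i) → PlugE (node f i ts C) w
  fromPlugE-sub : ∀ f i ts C w j → Dec (j ≡ i) → Edge (upd ts i (plug C w) j) → PlugE (node f i ts C) w
  fromPlugE hole            w e              = inj₂ e
  fromPlugE (node f i ts C) w (inj₁ j)       = fromPlugE-top f i ts C w j (j ≟ i)
  fromPlugE (node f i ts C) w (inj₂ (j , e)) = fromPlugE-sub f i ts C w j (j ≟ i) e
  fromPlugE-top f i ts C w j  (no j≢i)  = inj₁ (inj₁ (inj₁ (j , fromWitnessFalse j≢i)))
  fromPlugE-top f i ts C w .i (yes refl) = holeEdge f i ts C w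
  fromPlugE-sub f i ts C w j (no j≢i) e =
    inj₁ (inj₁ (inj₂ (inj₂ (inj₁ (j , fromWitnessFalse j≢i ,
                                   castE (sibling-arg f i ts C w j (fromWitnessFalse j≢i)) e)))))
  fromPlugE-sub f i ts C w .i (yes refl) e = deeperE f i ts C w (fromPlugE C w (castE (hole-arg f i ts C w) e))

  fromPlugE-top-hole : ∀ f i ts C w d → fromPlugE-top f i ts C w i d ≡ holeEdge f i ts C w
  fromPlugE-top-hole f i ts C w (yes refl) = refl
  fromPlugE-top-hole f i ts C w (no i≢i)   = ⊥-elim (i≢i refl)

  fromPlugE-top-sibling : ∀ f i ts C w j j≢i d → fromPlugE-top f i ts C w j d ≡ inj₁ (inj₁ (inj₁ (j , j≢i)))
  fromPlugE-top-sibling f i ts C w j j≢i (yes refl) = ⊥-elim (toWitnessFalse j≢i refl)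
  fromPlugE-top-sibling f i ts C w j j≢i (no _)     = cong (λ z → inj₁ (inj₁ (inj₁ (j , z)))) (T-irrelevant _ _)

  fromPlugE-sub-hole : ∀ f i ts C w d e →
    fromPlugE-sub f i ts C w i d (castE (sym (hole-arg f i ts C w)) e) ≡ deeperE f i ts C w (fromPlugE C w e)
  fromPlugE-sub-hole f i ts C w (yes refl) e =
    cong (λ y → deeperE f i ts C w (fromPlugE C w y)) (castE-cancel (sym (hole-arg f i ts C w)) (hole-arg f i ts C w) e)
  fromPlugE-sub-hole f i ts C w (no i≢i) e = ⊥-elim (i≢i refl)

  fromPlugE-sub-sibling : ∀ f i ts C w j j≢i d e →
    fromPlugE-sub f i ts C w j d (castE (sym (sibling-arg f i ts C w j j≢i)) e) ≡
    inj₁ (inj₁ (inj₂ (inj₂ (inj₁ (j , j≢i , e)))))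
  fromPlugE-sub-sibling f i ts C w j j≢i (yes refl) e = ⊥-elim (toWitnessFalse j≢i refl)
  fromPlugE-sub-sibling f i ts C w j j≢i (no _) e =
    cong₂ (λ a b → inj₁ (inj₁ (inj₂ (inj₂ (inj₁ (j , a , b)))))) (T-irrelevant _ _)
      (castE-cancel (sym (sibling-arg f i ts C w j j≢i)) (sibling-arg f i ts C w j (fromWitnessFalse (toWitnessFalse j≢i))) e)

  toPlugE-from : ∀ C w e → toPlugE C w (fromPlugE C w e) ≡ e
  toPlugE-fromPlugE-sub : ∀ f i ts C w j d e →
    toPlugE (node f i ts C) w (fromPlugE-sub f i ts C w j d e) ≡ inj₂ (j , e)
  toPlugE-from hole w e = refl
  toPlugE-from (node f i ts C) w (inj₁ j) with j ≟ i
  ... | no _     = refl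
  ... | yes refl = toPlugE-holeEdge f j ts C w
  toPlugE-from (node f i ts C) w (inj₂ (j , e)) = toPlugE-fromPlugE-sub f i ts C w j (j ≟ i) e
  toPlugE-fromPlugE-sub f i ts C w j (no j≢i) e =
    cong (λ z → inj₂ (j , z)) (castE-cancel (sibling-arg f i ts C w j (fromWitnessFalse j≢i))
                                            (sym (sibling-arg f i ts C w j (fromWitnessFalse j≢i))) e)
  toPlugE-fromPlugE-sub f i ts C w .i (yes refl) e = trans (toPlugE-deeperE f i ts C w _)
    (cong (λ z → inj₂ (i , z)) (trans (cong (castE (sym (hole-arg f i ts C w))) (toPlugE-from C w _))
                                      (castE-cancel (hole-arg f i ts C w) (sym (hole-arg f i ts C w)) e)))

  fromPlugE-to : ∀ C w a → fromPlugE C w (toPlugE C w a) ≡ a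
  fromPlugE-to-deeperE : ∀ f i ts C w a →
    fromPlugE (node f i ts C) w (inj₂ (i , castE (sym (hole-arg f i ts C w)) (toPlugE C w a))) ≡ deeperE f i ts C w a
  fromPlugE-to hole w (inj₁ (inj₁ ()))
  fromPlugE-to hole w (inj₁ (inj₂ ()))
  fromPlugE-to hole w (inj₂ e) = refl
  fromPlugE-to (node f i ts C) w (inj₁ (inj₁ (inj₁ (j , j≢i)))) = fromPlugE-top-sibling f i ts C w j j≢i (j ≟ i)
  fromPlugE-to (node f i ts (node _ _ _ _)) w (inj₁ (inj₁ (inj₂ (inj₁ tt)))) = fromPlugE-top-hole f i ts _ w (i ≟ i)
  fromPlugE-to (node f i ts C) w (inj₁ (inj₁ (inj₂ (inj₂ (inj₁ (j , j≢i , e)))))) =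
    fromPlugE-sub-sibling f i ts C w j j≢i (j ≟ i) e
  fromPlugE-to (node f i ts C) w (inj₁ (inj₁ (inj₂ (inj₂ (inj₂ c))))) = fromPlugE-to-deeperE f i ts C w (inj₁ (inj₁ c))
  fromPlugE-to (node f i ts hole) w (inj₁ (inj₂ tt)) = fromPlugE-top-hole f i ts hole w (i ≟ i)
  fromPlugE-to (node f i ts C@(node _ _ _ _)) w (inj₁ (inj₂ tt)) = fromPlugE-to-deeperE f i ts C w (inj₁ (inj₂ tt))
  fromPlugE-to (node f i ts C) w (inj₂ e) = fromPlugE-to-deeperE f i ts C w (inj₂ e)
  fromPlugE-to-deeperE f i ts C w a =
    trans (fromPlugE-sub-hole f i ts C w (i ≟ i) _) (cong (deeperE f i ts C w) (fromPlugE-to C w a))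
  ctxRoot : ∀ C → NonHole C → CtxV C
  ctxRoot (node f i ts C) _ = inj₁ tt

  ctxSrc : ∀ C → CtxE C → CtxV C
  ctxSrc (node f i ts C) (inj₁ _) = inj₁ tt
  ctxSrc (node f i ts C) (inj₂ (inj₁ _)) = inj₁ tt
  ctxSrc (node f i ts C) (inj₂ (inj₂ (inj₁ (j , j≢i , e)))) = inj₂ (inj₁ (j , j≢i , srcT (ts j) e))
  ctxSrc (node f i ts C) (inj₂ (inj₂ (inj₂ c))) = inj₂ (inj₂ (ctxSrc C c))

  ctxTgt : ∀ C → CtxE C → CtxV C
  ctxTgt (node f i ts C) (inj₁ (j , j≢i)) = inj₂ (inj₁ (j , j≢i , rootV (ts j)))
  ctxTgt (node f i ts C) (inj₂ (inj₁ nh)) = inj₂ (inj₂ (ctxRoot C nh))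
  ctxTgt (node f i ts C) (inj₂ (inj₂ (inj₁ (j , j≢i , e)))) = inj₂ (inj₁ (j , j≢i , tgtT (ts j) e))
  ctxTgt (node f i ts C) (inj₂ (inj₂ (inj₂ c))) = inj₂ (inj₂ (ctxTgt C c))

  holeEdgeSrc : ∀ C → NonHole C → CtxV C
  holeEdgeSrc (node f i ts hole) _ = inj₁ tt
  holeEdgeSrc (node f i ts C@(node _ _ _ _)) _ = inj₂ (inj₂ (holeEdgeSrc C tt))

  ctxℓV : ∀ C → CtxV C → Lbl
  ctxℓV (node f i ts C) (inj₁ _) = symL f
  ctxℓV (node f i ts C) (inj₂ (inj₁ (j , j≢i , x))) = ℓV (ts j °) x
  ctxℓV (node f i ts C) (inj₂ (inj₂ c)) = ctxℓV C c

  ctxℓE : ∀ C → CtxE C → Lbl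
  ctxℓE (node f i ts C) (inj₁ (j , _)) = arg (toℕ j)
  ctxℓE (node f i ts C) (inj₂ (inj₁ _)) = arg (toℕ i)
  ctxℓE (node f i ts C) (inj₂ (inj₂ (inj₁ (j , j≢i , e)))) = ℓEdge (ts j) e
  ctxℓE (node f i ts C) (inj₂ (inj₂ (inj₂ c))) = ctxℓE C c

  holeEdgeℓ : ∀ C → NonHole C → Lbl
  holeEdgeℓ (node f i ts hole) _ = arg (toℕ i)
  holeEdgeℓ (node f i ts C@(node _ _ _ _)) _ = holeEdgeℓ C tt

  module _ (f : Sym) (i : Fin (ar f)) (ts : Fin (ar f) → Term) (C : Ctx) (w : Term) where
    private
      down : plug C w ≡ upd ts i (plug C w) i
      down = sym (hole-arg f i ts C w)

    src-under-hole : ∀ e v → srcT (plug C w) e ≡ v →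
      srcT (plug (node f i ts C) w) (inj₂ (i , castE down e)) ≡ liftV f (upd ts i (plug C w)) i (castV down v)
    src-under-hole e v eq = cong (liftV f _ i) (trans (src-castE down e) (cong (castV down) eq))

    tgt-under-hole : ∀ e v → tgtT (plug C w) e ≡ v →
      tgtT (plug (node f i ts C) w) (inj₂ (i , castE down e)) ≡ liftV f (upd ts i (plug C w)) i (castV down v)
    tgt-under-hole e v eq = cong (liftV f _ i) (trans (tgt-castE down e) (cong (castV down) eq))

    ℓV-under-hole : ∀ v → ℓV (plug (node f i ts C) w °) (liftV f (upd ts i (plug C w)) i (castV down v)) ≡
                          ℓV (plug C w °) v
    ℓV-under-hole v = trans (ℓV-liftV f (upd ts i (plug C w)) i (castV down v)) (ℓV-castV down v)

  src-toPlugE-ctx : ∀ C w c → srcT (plug C w) (toPlugE C w (inj₁ (inj₁ c))) ≡ toPlugV C w (inj₁ (ctxSrc C c))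
  src-toPlugE-ctx (node f i ts C) w (inj₁ _) = refl
  src-toPlugE-ctx (node f i ts C) w (inj₂ (inj₁ _)) = refl
  src-toPlugE-ctx (node f i ts C) w (inj₂ (inj₂ (inj₁ (j , j≢i , e)))) =
    cong (liftV f _ j) (src-castE (sym (sibling-arg f i ts C w j j≢i)) e)
  src-toPlugE-ctx (node f i ts C) w (inj₂ (inj₂ (inj₂ c))) =
    src-under-hole f i ts C w _ _ (src-toPlugE-ctx C w c)

  tgt-toPlugE-ctx : ∀ C w c → tgtT (plug C w) (toPlugE C w (inj₁ (inj₁ c))) ≡ toPlugV C w (inj₁ (ctxTgt C c))
  tgt-toPlugE-ctx (node f i ts C) w (inj₁ (j , j≢i)) = cong (liftV f _ j) (rootV-castV (sym (sibling-arg f i ts C w j j≢i)))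
  tgt-toPlugE-ctx (node f i ts (node _ _ _ _)) w (inj₂ (inj₁ _)) = cong (liftV f _ i) (rootV-castV (sym (hole-arg f i ts _ w)))
  tgt-toPlugE-ctx (node f i ts C) w (inj₂ (inj₂ (inj₁ (j , j≢i , e)))) =
    cong (liftV f _ j) (tgt-castE (sym (sibling-arg f i ts C w j j≢i)) e)
  tgt-toPlugE-ctx (node f i ts C) w (inj₂ (inj₂ (inj₂ c))) =
    tgt-under-hole f i ts C w _ _ (tgt-toPlugE-ctx C w c)

  src-toPlugE-hole : ∀ C w nh → srcT (plug C w) (toPlugE C w (inj₁ (inj₂ nh))) ≡ toPlugV C w (inj₁ (holeEdgeSrc C nh))
  src-toPlugE-hole (node f i ts hole) w _ = refl
  src-toPlugE-hole (node f i ts C@(node _ _ _ _)) w _ = src-under-hole f i ts C w _ _ (src-toPlugE-hole C w tt)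

  tgt-toPlugE-hole : ∀ C w nh → tgtT (plug C w) (toPlugE C w (inj₁ (inj₂ nh))) ≡ toPlugV C w (inj₂ (rootV w))
  tgt-toPlugE-hole (node f i ts hole) w _ = cong (liftV f _ i) (rootV-castV (sym (hole-arg f i ts hole w)))
  tgt-toPlugE-hole (node f i ts C@(node _ _ _ _)) w _ = tgt-under-hole f i ts C w _ _ (tgt-toPlugE-hole C w tt)

  src-toPlugE-inner : ∀ C w e → srcT (plug C w) (toPlugE C w (inj₂ e)) ≡ toPlugV C w (inj₂ (srcT w e))
  src-toPlugE-inner hole w e = refl
  src-toPlugE-inner (node f i ts C) w e = src-under-hole f i ts C w _ _ (src-toPlugE-inner C w e)

  tgt-toPlugE-inner : ∀ C w e → tgtT (plug C w) (toPlugE C w (inj₂ e)) ≡ toPlugV C w (inj₂ (tgtT w e))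
  tgt-toPlugE-inner hole w e = refl
  tgt-toPlugE-inner (node f i ts C) w e = tgt-under-hole f i ts C w _ _ (tgt-toPlugE-inner C w e)

  ℓV-toPlugV-ctx : ∀ C w c → ℓV (plug C w °) (toPlugV C w (inj₁ c)) ≡ ctxℓV C c
  ℓV-toPlugV-ctx (node f i ts C) w (inj₁ _) = refl
  ℓV-toPlugV-ctx (node f i ts C) w (inj₂ (inj₁ (j , j≢i , x))) =
    trans (ℓV-liftV f (upd ts i (plug C w)) j (castV (sym (sibling-arg f i ts C w j j≢i)) x))
          (ℓV-castV (sym (sibling-arg f i ts C w j j≢i)) x)
  ℓV-toPlugV-ctx (node f i ts C) w (inj₂ (inj₂ c)) = trans (ℓV-under-hole f i ts C w _) (ℓV-toPlugV-ctx C w c)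

  ℓV-toPlugV-inner : ∀ C w v → ℓV (plug C w °) (toPlugV C w (inj₂ v)) ≡ ℓV (w °) v
  ℓV-toPlugV-inner hole w v = refl
  ℓV-toPlugV-inner (node f i ts C) w v = trans (ℓV-under-hole f i ts C w _) (ℓV-toPlugV-inner C w v)

  ℓE-toPlugE-ctx : ∀ C w c → ℓEdge (plug C w) (toPlugE C w (inj₁ (inj₁ c))) ≡ ctxℓE C c
  ℓE-toPlugE-ctx (node f i ts C) w (inj₁ _) = refl
  ℓE-toPlugE-ctx (node f i ts C) w (inj₂ (inj₁ _)) = refl
  ℓE-toPlugE-ctx (node f i ts C) w (inj₂ (inj₂ (inj₁ (j , j≢i , e)))) = ℓE-castE (sym (sibling-arg f i ts C w j j≢i)) e
  ℓE-toPlugE-ctx (node f i ts C) w (inj₂ (inj₂ (inj₂ c))) =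
    trans (ℓE-castE (sym (hole-arg f i ts C w)) _) (ℓE-toPlugE-ctx C w c)

  ℓE-toPlugE-hole : ∀ C w nh → ℓEdge (plug C w) (toPlugE C w (inj₁ (inj₂ nh))) ≡ holeEdgeℓ C nh
  ℓE-toPlugE-hole (node f i ts hole) w _ = refl
  ℓE-toPlugE-hole (node f i ts C@(node _ _ _ _)) w _ = trans (ℓE-castE (sym (hole-arg f i ts C w)) _) (ℓE-toPlugE-hole C w tt)

  ℓE-toPlugE-inner : ∀ C w e → ℓEdge (plug C w) (toPlugE C w (inj₂ e)) ≡ ℓEdge w e
  ℓE-toPlugE-inner hole w e = refl
  ℓE-toPlugE-inner (node f i ts C) w e = trans (ℓE-castE (sym (hole-arg f i ts C w)) _) (ℓE-toPlugE-inner C w e)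

  funPos-toPlugV : ∀ C w q → Σ (FunPos (plug C w)) λ q' →
         (toPlugV C w (inj₂ (inj₁ q)) ≡ inj₁ q') × (funPos (plug C w) q' ≡ holePos C ++ funPos w q)
  funPos-toPlugV hole w q = q , refl , refl
  funPos-toPlugV (node f i ts C) w q with funPos-toPlugV C w q
  ... | q₁ , e₁ , p₁ with funPos-castV (sym (hole-arg f i ts C w)) q₁
  ... | q₂ , e₂ , p₂ = inj₂ (i , q₂) ,
        cong (liftV f _ i) (trans (cong (castV (sym (hole-arg f i ts C w))) e₁) e₂) ,
        cong (suc (toℕ i) ∷_) (trans p₂ p₁)


-- The vertices of u[σ]° are the function positions of u together with, for each
-- variable x of u, the vertices of σ x; likewise for edges.
module SubstDecomposition (𝕊 : Signature) (σ : ℕ → Sig.Term 𝕊) where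
  open Signature 𝕊
  open Sig 𝕊 renaming (sym to symL)
  open TermGraphFacts 𝕊

  SubstV SubstE InstV InstE : Term → Set
  SubstV u = Σ (Vars u) λ x → Vert (σ (proj₁ x))
  SubstE u = Σ (Vars u) λ x → Edge (σ (proj₁ x))
  InstV u = FunPos u ⊎ SubstV u
  InstE u = Edge u ⊎ SubstE u

  ArgWith : ∀ f (ts : Fin (ar f) → Term) → ℕ → Set
  ArgWith f ts x = Σ (Fin (ar f)) λ j → T (occurs x (ts j))

  occurs-arg : ∀ f ts x → T (occurs x (fun f ts)) → ArgWith f ts x
  occurs-arg f ts x = anyFin-witness (ar f) (λ j → occurs x (ts j))

  occurs-self : ∀ x → T (occurs x (var x))
  occurs-self x = ≡⇒≡ᵇ x x refl

  Linear-arg-inst : ∀ f ts → Linear (fun f ts [ σ ]) → ∀ i → Linear (ts i [ σ ])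
  Linear-arg-inst f ts = Linear-arg f (λ j → ts j [ σ ])

  toInstV : ∀ u → InstV u → Vert (u [ σ ])
  toInstV-var : ∀ f ts x → ArgWith f ts x → Vert (σ x) → Vert (fun f ts [ σ ])
  toInstV (var y)    (inj₂ ((x , p) , v))  = castV (cong σ (≡ᵇ⇒≡ x y p)) v
  toInstV (fun f ts) (inj₁ (inj₁ _))       = inj₁ (inj₁ tt)
  toInstV (fun f ts) (inj₁ (inj₂ (i , q))) = liftV f (λ j → ts j [ σ ]) i (toInstV (ts i) (inj₁ q))
  toInstV (fun f ts) (inj₂ ((x , p) , v))  = toInstV-var f ts x (occurs-arg f ts x p) v
  toInstV-var f ts x (i , q) v = liftV f (λ j → ts j [ σ ]) i (toInstV (ts i) (inj₂ ((x , q) , v)))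

  fromInstV : ∀ u → Vert (u [ σ ]) → InstV u
  fromInstV-arg : ∀ f ts i → InstV (ts i) → InstV (fun f ts)
  fromInstV-layer : ∀ f ts → Layer f (λ j → ts j [ σ ]) → InstV (fun f ts)
  fromInstV (var y)    v = inj₂ ((y , occurs-self y) , v)
  fromInstV (fun f ts) v = fromInstV-layer f ts (layer-from f (λ j → ts j [ σ ]) v)
  fromInstV-layer f ts (inj₁ _)       = inj₁ (inj₁ tt)
  fromInstV-layer f ts (inj₂ (i , v)) = fromInstV-arg f ts i (fromInstV (ts i) v)
  fromInstV-arg f ts i (inj₁ q)              = inj₁ (inj₂ (i , q))
  fromInstV-arg f ts i (inj₂ ((x , q) , v)) = inj₂ ((x , anyFin-intro (ar f) (λ j → occurs x (ts j)) i q) , v)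

  toInstV-fromInstV-arg : ∀ f ts → Linear (fun f ts) → ∀ i a →
    toInstV (fun f ts) (fromInstV-arg f ts i a) ≡ liftV f (λ j → ts j [ σ ]) i (toInstV (ts i) a)
  toInstV-fromInstV-arg f ts lin i (inj₁ q) = refl
  toInstV-fromInstV-arg f ts lin i (inj₂ ((x , q) , v)) =
    cong (λ z → toInstV-var f ts x z v) (Linear-witness-unique f ts lin x i q _)

  toInstV-from : ∀ u → Linear u → ∀ v → toInstV u (fromInstV u v) ≡ v
  toInstV-from (var y)    lin v = castV-refl _ v
  toInstV-from (fun f ts) lin v = trans (fromLayer (layer-from f _ v)) (layer-to-from f _ v)
    where
    fromLayer : ∀ a → toInstV (fun f ts) (fromInstV-layer f ts a) ≡ layer-to f (λ j → ts j [ σ ]) a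
    fromLayer (inj₁ _)       = refl
    fromLayer (inj₂ (i , v)) = trans (toInstV-fromInstV-arg f ts lin i (fromInstV (ts i) v))
                                     (cong (liftV f _ i) (toInstV-from (ts i) (Linear-arg f ts lin i) v))

  SubstV-var-≡ : ∀ x y (x≡y : x ≡ y) (p : T (occurs x (var y))) (q : T (occurs y (var y))) (v : Vert (σ x)) →
                 _≡_ {A = SubstV (var y)} ((y , q) , castV (cong σ x≡y) v) ((x , p) , v)
  SubstV-var-≡ x .x refl p q v = cong (λ z → (x , z) , v) (T-irrelevant q p)

  fromInstV-to : ∀ u → Linear (u [ σ ]) → ∀ a → fromInstV u (toInstV u a) ≡ a
  fromInstV-to (var y) lin (inj₂ ((x , p) , v)) = cong inj₂ (SubstV-var-≡ x y (≡ᵇ⇒≡ x y p) p (occurs-self y) v)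
  fromInstV-to (fun f ts) lin (inj₁ (inj₁ _)) = refl
  fromInstV-to (fun f ts) lin (inj₁ (inj₂ (i , q))) =
    trans (cong (fromInstV-layer f ts) (layer-from-to f _ lin (inj₂ (i , _))))
          (cong (fromInstV-arg f ts i) (fromInstV-to (ts i) (Linear-arg-inst f ts lin i) (inj₁ q)))
  fromInstV-to (fun f ts) lin (inj₂ ((x , p) , v)) with occurs-arg f ts x p
  ... | i , q = trans (cong (fromInstV-layer f ts) (layer-from-to f _ lin (inj₂ (i , _))))
          (trans (cong (fromInstV-arg f ts i) (fromInstV-to (ts i) (Linear-arg-inst f ts lin i) (inj₂ ((x , q) , v))))
                 (cong (λ z → inj₂ ((x , z) , v)) (T-irrelevant _ p)))

  toInstE : ∀ u → InstE u → Edge (u [ σ ])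
  toInstE-var : ∀ f ts x → ArgWith f ts x → Edge (σ x) → Edge (fun f ts [ σ ])
  toInstE (var y)    (inj₂ ((x , p) , e))  = castE (cong σ (≡ᵇ⇒≡ x y p)) e
  toInstE (fun f ts) (inj₁ (inj₁ i))       = inj₁ i
  toInstE (fun f ts) (inj₁ (inj₂ (i , e))) = inj₂ (i , toInstE (ts i) (inj₁ e))
  toInstE (fun f ts) (inj₂ ((x , p) , e))  = toInstE-var f ts x (occurs-arg f ts x p) e
  toInstE-var f ts x (i , q) e = inj₂ (i , toInstE (ts i) (inj₂ ((x , q) , e)))

  fromInstE : ∀ u → Edge (u [ σ ]) → InstE u
  fromInstE-arg : ∀ f ts i → InstE (ts i) → InstE (fun f ts)
  fromInstE (var y)    e              = inj₂ ((y , occurs-self y) , e)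
  fromInstE (fun f ts) (inj₁ i)       = inj₁ (inj₁ i)
  fromInstE (fun f ts) (inj₂ (i , e)) = fromInstE-arg f ts i (fromInstE (ts i) e)
  fromInstE-arg f ts i (inj₁ e)              = inj₁ (inj₂ (i , e))
  fromInstE-arg f ts i (inj₂ ((x , q) , e)) = inj₂ ((x , anyFin-intro (ar f) (λ j → occurs x (ts j)) i q) , e)

  toInstE-fromInstE-arg : ∀ f ts → Linear (fun f ts) → ∀ i a →
    toInstE (fun f ts) (fromInstE-arg f ts i a) ≡ inj₂ (i , toInstE (ts i) a)
  toInstE-fromInstE-arg f ts lin i (inj₁ e) = refl
  toInstE-fromInstE-arg f ts lin i (inj₂ ((x , q) , e)) =
    cong (λ z → toInstE-var f ts x z e) (Linear-witness-unique f ts lin x i q _)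

  toInstE-from : ∀ u → Linear u → ∀ e → toInstE u (fromInstE u e) ≡ e
  toInstE-from (var y)    lin e              = castE-refl _ e
  toInstE-from (fun f ts) lin (inj₁ i)       = refl
  toInstE-from (fun f ts) lin (inj₂ (i , e)) =
    trans (toInstE-fromInstE-arg f ts lin i (fromInstE (ts i) e))
          (cong (λ z → inj₂ (i , z)) (toInstE-from (ts i) (Linear-arg f ts lin i) e))

  SubstE-var-≡ : ∀ x y (x≡y : x ≡ y) (p : T (occurs x (var y))) (q : T (occurs y (var y))) (e : Edge (σ x)) →
                 _≡_ {A = SubstE (var y)} ((y , q) , castE (cong σ x≡y) e) ((x , p) , e)
  SubstE-var-≡ x .x refl p q e = cong (λ z → (x , z) , e) (T-irrelevant q p)

  fromInstE-to : ∀ u a → fromInstE u (toInstE u a) ≡ a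
  fromInstE-to (var y) (inj₂ ((x , p) , e)) = cong inj₂ (SubstE-var-≡ x y (≡ᵇ⇒≡ x y p) p (occurs-self y) e)
  fromInstE-to (fun f ts) (inj₁ (inj₁ i)) = refl
  fromInstE-to (fun f ts) (inj₁ (inj₂ (i , e))) = cong (fromInstE-arg f ts i) (fromInstE-to (ts i) (inj₁ e))
  fromInstE-to (fun f ts) (inj₂ ((x , p) , e)) with occurs-arg f ts x p
  ... | i , q = trans (cong (fromInstE-arg f ts i) (fromInstE-to (ts i) (inj₂ ((x , q) , e))))
                      (cong (λ z → inj₂ ((x , z) , e)) (T-irrelevant _ p))

  patternV : ∀ u → Vert u → InstV u
  patternV u (inj₁ q) = inj₁ q
  patternV u (inj₂ x) = inj₂ (x , rootV (σ (proj₁ x)))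

  instSrc instTgt : ∀ u → InstE u → InstV u
  instSrc u (inj₁ e)       = patternV u (srcT u e)
  instSrc u (inj₂ (x , e)) = inj₂ (x , srcT (σ (proj₁ x)) e)
  instTgt u (inj₁ e)       = patternV u (tgtT u e)
  instTgt u (inj₂ (x , e)) = inj₂ (x , tgtT (σ (proj₁ x)) e)

  instℓV : ∀ u → InstV u → Lbl
  instℓV u (inj₁ q)       = symL (symAt u q)
  instℓV u (inj₂ (x , v)) = ℓV (σ (proj₁ x) °) v

  instℓE : ∀ u → InstE u → Lbl
  instℓE u (inj₁ e)       = ℓEdge u e
  instℓE u (inj₂ (x , e)) = ℓEdge (σ (proj₁ x)) e

  toInstV-patternV-liftV : ∀ f ts → Linear (fun f ts) → ∀ i v →
    toInstV (fun f ts) (patternV (fun f ts) (liftV f ts i v)) ≡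
    liftV f (λ j → ts j [ σ ]) i (toInstV (ts i) (patternV (ts i) v))
  toInstV-patternV-liftV f ts lin i (inj₁ q) = refl
  toInstV-patternV-liftV f ts lin i (inj₂ (x , q)) =
    cong (λ z → toInstV-var f ts x z (rootV (σ x))) (Linear-witness-unique f ts lin x i q _)

  rootV-toInstV : ∀ u → rootV (u [ σ ]) ≡ toInstV u (patternV u (rootV u))
  rootV-toInstV (var y)    = sym (castV-refl _ _)
  rootV-toInstV (fun g us) = refl

  src-toInstE : ∀ u → Linear u → ∀ c → srcT (u [ σ ]) (toInstE u c) ≡ toInstV u (instSrc u c)
  src-toInstE (var y) lin (inj₂ ((x , p) , e)) = src-castE (cong σ (≡ᵇ⇒≡ x y p)) e
  src-toInstE (fun f ts) lin (inj₁ (inj₁ i)) = refl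
  src-toInstE (fun f ts) lin (inj₁ (inj₂ (i , e))) =
    trans (cong (liftV f _ i) (src-toInstE (ts i) (Linear-arg f ts lin i) (inj₁ e)))
          (sym (toInstV-patternV-liftV f ts lin i (srcT (ts i) e)))
  src-toInstE (fun f ts) lin (inj₂ ((x , p) , e)) with occurs-arg f ts x p
  ... | i , q = cong (liftV f _ i) (src-toInstE (ts i) (Linear-arg f ts lin i) (inj₂ ((x , q) , e)))

  tgt-toInstE : ∀ u → Linear u → ∀ c → tgtT (u [ σ ]) (toInstE u c) ≡ toInstV u (instTgt u c)
  tgt-toInstE (var y) lin (inj₂ ((x , p) , e)) = tgt-castE (cong σ (≡ᵇ⇒≡ x y p)) e
  tgt-toInstE (fun f ts) lin (inj₁ (inj₁ i)) =
    trans (cong (liftV f _ i) (rootV-toInstV (ts i))) (sym (toInstV-patternV-liftV f ts lin i (rootV (ts i))))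
  tgt-toInstE (fun f ts) lin (inj₁ (inj₂ (i , e))) =
    trans (cong (liftV f _ i) (tgt-toInstE (ts i) (Linear-arg f ts lin i) (inj₁ e)))
          (sym (toInstV-patternV-liftV f ts lin i (tgtT (ts i) e)))
  tgt-toInstE (fun f ts) lin (inj₂ ((x , p) , e)) with occurs-arg f ts x p
  ... | i , q = cong (liftV f _ i) (tgt-toInstE (ts i) (Linear-arg f ts lin i) (inj₂ ((x , q) , e)))

  ℓV-toInstV : ∀ u a → ℓV (u [ σ ] °) (toInstV u a) ≡ instℓV u a
  ℓV-toInstV (var y) (inj₂ ((x , p) , v)) = ℓV-castV (cong σ (≡ᵇ⇒≡ x y p)) v
  ℓV-toInstV (fun f ts) (inj₁ (inj₁ _)) = refl
  ℓV-toInstV (fun f ts) (inj₁ (inj₂ (i , q))) =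
    trans (ℓV-liftV f (λ j → ts j [ σ ]) i (toInstV (ts i) (inj₁ q))) (ℓV-toInstV (ts i) (inj₁ q))
  ℓV-toInstV (fun f ts) (inj₂ ((x , p) , v)) with occurs-arg f ts x p
  ... | i , q = trans (ℓV-liftV f (λ j → ts j [ σ ]) i (toInstV (ts i) (inj₂ ((x , q) , v))))
                      (ℓV-toInstV (ts i) (inj₂ ((x , q) , v)))

  ℓE-toInstE : ∀ u a → ℓEdge (u [ σ ]) (toInstE u a) ≡ instℓE u a
  ℓE-toInstE (var y) (inj₂ ((x , p) , e)) = ℓE-castE (cong σ (≡ᵇ⇒≡ x y p)) e
  ℓE-toInstE (fun f ts) (inj₁ (inj₁ i)) = refl
  ℓE-toInstE (fun f ts) (inj₁ (inj₂ (i , e))) = ℓE-toInstE (ts i) (inj₁ e)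
  ℓE-toInstE (fun f ts) (inj₂ ((x , p) , e)) with occurs-arg f ts x p
  ... | i , q = ℓE-toInstE (ts i) (inj₂ ((x , q) , e))

module OccurrenceDecomposition (𝕊 : Signature) (σ : ℕ → Sig.Term 𝕊) (C : Sig.Ctx 𝕊) (u : Sig.Term 𝕊)
  (linU : Sig.Linear 𝕊 u) (linCuσ : Sig.Linear 𝕊 (Sig.plug 𝕊 C (Sig._[_] 𝕊 u σ))) where
  open Sig 𝕊 renaming (sym to symL)
  open TermGraphFacts 𝕊
  open PlugDecomposition 𝕊
  open SubstDecomposition 𝕊 σ
  open GraphFacts 𝕊 using (≤L-≡ʳ)

  uσ C[uσ] : Term
  uσ = u [ σ ]
  C[uσ] = plug C uσ

  OccV OccE : Set
  OccV = CtxV C ⊎ InstV u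
  OccE = (CtxE C ⊎ NonHole C) ⊎ InstE u

  toOccV : OccV → Vert C[uσ]
  toOccV (inj₁ c) = toPlugV C uσ (inj₁ c)
  toOccV (inj₂ a) = toPlugV C uσ (inj₂ (toInstV u a))

  toOccE : OccE → Edge C[uσ]
  toOccE (inj₁ c) = toPlugE C uσ (inj₁ c)
  toOccE (inj₂ a) = toPlugE C uσ (inj₂ (toInstE u a))

  fromOccV : Vert C[uσ] → OccV
  fromOccV v with fromPlugV C uσ v
  ... | inj₁ c = inj₁ c
  ... | inj₂ y = inj₂ (fromInstV u y)

  fromOccE : Edge C[uσ] → OccE
  fromOccE e with fromPlugE C uσ e
  ... | inj₁ c = inj₁ c
  ... | inj₂ y = inj₂ (fromInstE u y)

  toOccV-from : ∀ v → toOccV (fromOccV v) ≡ v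
  toOccV-from v with fromPlugV C uσ v | toPlugV-from C uσ v
  ... | inj₁ c | eq = eq
  ... | inj₂ y | eq = trans (cong (λ z → toPlugV C uσ (inj₂ z)) (toInstV-from u linU y)) eq

  toOccE-from : ∀ e → toOccE (fromOccE e) ≡ e
  toOccE-from e with fromPlugE C uσ e | toPlugE-from C uσ e
  ... | inj₁ c | eq = eq
  ... | inj₂ y | eq = trans (cong (λ z → toPlugE C uσ (inj₂ z)) (toInstE-from u linU y)) eq

  fromOccV-to : ∀ a → fromOccV (toOccV a) ≡ a
  fromOccV-to (inj₁ c) rewrite fromPlugV-to C uσ linCuσ (inj₁ c) = refl
  fromOccV-to (inj₂ a) rewrite fromPlugV-to C uσ linCuσ (inj₂ (toInstV u a)) =
    cong inj₂ (fromInstV-to u (Linear-plugged C uσ linCuσ) a)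

  fromOccE-to : ∀ a → fromOccE (toOccE a) ≡ a
  fromOccE-to (inj₁ c) rewrite fromPlugE-to C uσ (inj₁ c) = refl
  fromOccE-to (inj₂ a) rewrite fromPlugE-to C uσ (inj₂ (toInstE u a)) = cong inj₂ (fromInstE-to u a)

  occSrc occTgt : OccE → OccV
  occSrc (inj₁ (inj₁ c))  = inj₁ (ctxSrc C c)
  occSrc (inj₁ (inj₂ nh)) = inj₁ (holeEdgeSrc C nh)
  occSrc (inj₂ a)         = inj₂ (instSrc u a)
  occTgt (inj₁ (inj₁ c))  = inj₁ (ctxTgt C c)
  occTgt (inj₁ (inj₂ nh)) = inj₂ (patternV u (rootV u))
  occTgt (inj₂ a)         = inj₂ (instTgt u a)

  occℓV : OccV → Lbl
  occℓV (inj₁ c) = ctxℓV C c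
  occℓV (inj₂ a) = instℓV u a

  occℓE : OccE → Lbl
  occℓE (inj₁ (inj₁ c))  = ctxℓE C c
  occℓE (inj₁ (inj₂ nh)) = holeEdgeℓ C nh
  occℓE (inj₂ a)         = instℓE u a

  src-toOccE : ∀ c → srcT C[uσ] (toOccE c) ≡ toOccV (occSrc c)
  src-toOccE (inj₁ (inj₁ c))  = src-toPlugE-ctx C uσ c
  src-toOccE (inj₁ (inj₂ nh)) = src-toPlugE-hole C uσ nh
  src-toOccE (inj₂ a) =
    trans (src-toPlugE-inner C uσ (toInstE u a)) (cong (λ z → toPlugV C uσ (inj₂ z)) (src-toInstE u linU a))

  tgt-toOccE : ∀ c → tgtT C[uσ] (toOccE c) ≡ toOccV (occTgt c)
  tgt-toOccE (inj₁ (inj₁ c))  = tgt-toPlugE-ctx C uσ c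
  tgt-toOccE (inj₁ (inj₂ nh)) =
    trans (tgt-toPlugE-hole C uσ nh) (cong (λ z → toPlugV C uσ (inj₂ z)) (rootV-toInstV u))
  tgt-toOccE (inj₂ a) =
    trans (tgt-toPlugE-inner C uσ (toInstE u a)) (cong (λ z → toPlugV C uσ (inj₂ z)) (tgt-toInstE u linU a))

  ℓV-toOccV : ∀ a → ℓV (C[uσ] °) (toOccV a) ≡ occℓV a
  ℓV-toOccV (inj₁ c) = ℓV-toPlugV-ctx C uσ c
  ℓV-toOccV (inj₂ a) = trans (ℓV-toPlugV-inner C uσ (toInstV u a)) (ℓV-toInstV u a)

  ℓE-toOccE : ∀ a → ℓEdge C[uσ] (toOccE a) ≡ occℓE a
  ℓE-toOccE (inj₁ (inj₁ c))  = ℓE-toPlugE-ctx C uσ c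
  ℓE-toOccE (inj₁ (inj₂ nh)) = ℓE-toPlugE-hole C uσ nh
  ℓE-toOccE (inj₂ a)         = trans (ℓE-toPlugE-inner C uσ (toInstE u a)) (ℓE-toInstE u a)

  ℓV-fromOccV : ∀ v → ℓV (C[uσ] °) v ≡ occℓV (fromOccV v)
  ℓV-fromOccV v = trans (cong (ℓV (C[uσ] °)) (sym (toOccV-from v))) (ℓV-toOccV (fromOccV v))

  ℓE-fromOccE : ∀ e → ℓEdge C[uσ] e ≡ occℓE (fromOccE e)
  ℓE-fromOccE e = trans (cong (ℓEdge C[uσ]) (sym (toOccE-from e))) (ℓE-toOccE (fromOccE e))

  fromOccV-src : ∀ e → fromOccV (srcT C[uσ] e) ≡ occSrc (fromOccE e)
  fromOccV-src e = begin
    fromOccV (srcT C[uσ] e)                    ≡⟨ cong (λ z → fromOccV (srcT C[uσ] z)) (sym (toOccE-from e)) ⟩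
    fromOccV (srcT C[uσ] (toOccE (fromOccE e))) ≡⟨ cong fromOccV (src-toOccE (fromOccE e)) ⟩
    fromOccV (toOccV (occSrc (fromOccE e)))     ≡⟨ fromOccV-to _ ⟩
    occSrc (fromOccE e)                         ∎
    where open ≡-Reasoning

  fromOccV-tgt : ∀ e → fromOccV (tgtT C[uσ] e) ≡ occTgt (fromOccE e)
  fromOccV-tgt e = begin
    fromOccV (tgtT C[uσ] e)                    ≡⟨ cong (λ z → fromOccV (tgtT C[uσ] z)) (sym (toOccE-from e)) ⟩
    fromOccV (tgtT C[uσ] (toOccE (fromOccE e))) ≡⟨ cong fromOccV (tgt-toOccE (fromOccE e)) ⟩
    fromOccV (toOccV (occTgt (fromOccE e)))     ≡⟨ fromOccV-to _ ⟩
    occTgt (fromOccE e)                         ∎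
    where open ≡-Reasoning

  patternHom : Hom (u °) (C[uσ] °)
  patternHom = record
    { fV = λ v → toOccV (inj₂ (patternV u v))
    ; fE = λ e → toOccE (inj₂ (inj₁ e))
    ; src-comm = λ e → sym (src-toOccE (inj₂ (inj₁ e)))
    ; tgt-comm = λ e → sym (tgt-toOccE (inj₂ (inj₁ e)))
    ; ℓV-mono = λ v → ≤L-≡ʳ (ℓ-patternV v) (sym (ℓV-toOccV (inj₂ (patternV u v))))
    ; ℓE-mono = λ e → ≤L-≡ʳ ≤refl (sym (ℓE-toOccE (inj₂ (inj₁ e)))) }
    where
    ℓ-patternV : ∀ v → ℓV (u °) v ≤L instℓV u (patternV u v)
    ℓ-patternV (inj₁ q) = ≤refl
    ℓ-patternV (inj₂ x) = bot≤

module Simulation (𝕊 : Signature) (ρ : Sig.TRule 𝕊) (σ : ℕ → Sig.Term 𝕊) (C : Sig.Ctx 𝕊)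
  (linl : Sig.Linear 𝕊 (Sig.TRule.lhs ρ)) (linr : Sig.Linear 𝕊 (Sig.TRule.rhs ρ))
  (linS : Sig.Linear 𝕊 (Sig.plug 𝕊 C (Sig._[_] 𝕊 (Sig.TRule.lhs ρ) σ)))
  (linT : Sig.Linear 𝕊 (Sig.plug 𝕊 C (Sig._[_] 𝕊 (Sig.TRule.rhs ρ) σ))) where
  open Sig 𝕊 renaming (sym to symL)
  open GraphFacts 𝕊
  open TermGraphFacts 𝕊
  open PlugDecomposition 𝕊
  open SubstDecomposition 𝕊 σ
  open TRule ρ renaming (lhs to l; rhs to r)
  open Enc ρ

  module Redex = OccurrenceDecomposition 𝕊 σ C l linl linS
  module Reduct = OccurrenceDecomposition 𝕊 σ C r linr linT

  s t : Term
  s = Redex.C[uσ]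
  t = Reduct.C[uσ]

  L' K' : Graph
  L' = closure (encT l)
  K' = closure (encI r)

  tL : Hom (l °) L'
  tL = incl (encT l)

  m : Hom (l °) (s °)
  m = Redex.patternHom

  αVar : Vars l → Bool → V L'
  αVar x true  = inj₁ (inj₂ x)
  αVar x false = inj₂ (inj₁ x)

  αVarE : Vars l → Bool → E L'
  αVarE x true  = inj₂ (inj₁ (inj₁ x))
  αVarE x false = inj₂ (inj₁ (inj₂ x))

  αOcc : Redex.OccV → V L'
  αOcc (inj₁ c)              = inj₂ (inj₂ tt)
  αOcc (inj₂ (inj₁ q))       = inj₁ (inj₁ q)
  αOcc (inj₂ (inj₂ (x , v))) = αVar x (isRoot (σ (proj₁ x)) v)

  αOccE : Redex.OccE → E L'
  αOccE (inj₁ (inj₁ c))       = inj₂ (inj₂ (inj₂ tt))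
  αOccE (inj₁ (inj₂ nh))      = inj₂ (inj₂ (inj₁ tt))
  αOccE (inj₂ (inj₁ e))       = inj₁ e
  αOccE (inj₂ (inj₂ (x , e))) = αVarE x (isTop (σ (proj₁ x)) e)

  αVar-src : ∀ x b → αVar x b ≡ src L' (αVarE x b)
  αVar-src x true  = refl
  αVar-src x false = refl

  αVar-tgt : ∀ x b → αVar x false ≡ tgt L' (αVarE x b)
  αVar-tgt x true  = refl
  αVar-tgt x false = refl

  ≤L-ℓαVar : ∀ {a} x b → a ≤L ℓV L' (αVar x b)
  ≤L-ℓαVar x true  = ≤top
  ≤L-ℓαVar x false = ≤top

  ≤L-ℓαVarE : ∀ {a} x b → a ≤L ℓE L' (αVarE x b)
  ≤L-ℓαVarE x true  = ≤top
  ≤L-ℓαVarE x false = ≤top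

  patternOcc : Vert l → Redex.OccV
  patternOcc v = inj₂ (patternV l v)

  αOcc-pattern : ∀ v → αOcc (patternOcc v) ≡ inj₁ v
  αOcc-pattern (inj₁ q) = refl
  αOcc-pattern (inj₂ x) = cong (αVar x) (isRoot-rootV (σ (proj₁ x)))

  αOcc-src : ∀ c → αOcc (Redex.occSrc c) ≡ src L' (αOccE c)
  αOcc-src (inj₁ (inj₁ c))       = refl
  αOcc-src (inj₁ (inj₂ nh))      = refl
  αOcc-src (inj₂ (inj₁ e))       = αOcc-pattern (srcT l e)
  αOcc-src (inj₂ (inj₂ (x , e))) =
    trans (cong (αVar x) (isRoot-src (σ (proj₁ x)) e)) (αVar-src x (isTop (σ (proj₁ x)) e))

  αOcc-tgt : ∀ c → αOcc (Redex.occTgt c) ≡ tgt L' (αOccE c)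
  αOcc-tgt (inj₁ (inj₁ c))       = refl
  αOcc-tgt (inj₁ (inj₂ nh))      = αOcc-pattern (rootV l)
  αOcc-tgt (inj₂ (inj₁ e))       = αOcc-pattern (tgtT l e)
  αOcc-tgt (inj₂ (inj₂ (x , e))) =
    trans (cong (αVar x) (isRoot-tgt (σ (proj₁ x)) e)) (αVar-tgt x (isTop (σ (proj₁ x)) e))

  αOcc-ℓV : ∀ a → Redex.occℓV a ≤L ℓV L' (αOcc a)
  αOcc-ℓV (inj₁ c)              = ≤top
  αOcc-ℓV (inj₂ (inj₁ q))       = ≤refl
  αOcc-ℓV (inj₂ (inj₂ (x , v))) = ≤L-ℓαVar x (isRoot (σ (proj₁ x)) v)

  αOcc-ℓE : ∀ a → Redex.occℓE a ≤L ℓE L' (αOccE a)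
  αOcc-ℓE (inj₁ (inj₁ c))       = ≤top
  αOcc-ℓE (inj₁ (inj₂ nh))      = ≤top
  αOcc-ℓE (inj₂ (inj₁ e))       = ≤refl
  αOcc-ℓE (inj₂ (inj₂ (x , e))) = ≤L-ℓαVarE x (isTop (σ (proj₁ x)) e)

  α : Hom (s °) L'
  α = record
    { fV = λ v → αOcc (Redex.fromOccV v)
    ; fE = λ e → αOccE (Redex.fromOccE e)
    ; src-comm = λ e → trans (cong αOcc (Redex.fromOccV-src e)) (αOcc-src (Redex.fromOccE e))
    ; tgt-comm = λ e → trans (cong αOcc (Redex.fromOccV-tgt e)) (αOcc-tgt (Redex.fromOccE e))
    ; ℓV-mono = λ v → ≤L-≡ˡ (Redex.ℓV-fromOccV v) (αOcc-ℓV (Redex.fromOccV v))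
    ; ℓE-mono = λ e → ≤L-≡ˡ (Redex.ℓE-fromOccE e) (αOcc-ℓE (Redex.fromOccE e)) }

  α∘m≈tL : (α ∘H m) ≈H tL
  α∘m≈tL = (λ v → trans (cong αOcc (Redex.fromOccV-to (patternOcc v))) (αOcc-pattern v)) ,
           (λ e → cong αOccE (Redex.fromOccE-to (inj₂ (inj₁ e))))

  αOcc-reflects : ∀ y a → αOcc y ≡ inj₁ a → y ≡ patternOcc a
  αOcc-reflects (inj₂ (inj₁ q)) .(inj₁ q) refl = refl
  αOcc-reflects (inj₂ (inj₂ (x , v))) a αy≡a with isRoot (σ (proj₁ x)) v in isRoot≡ | αy≡a
  ... | true | refl = cong (λ z → inj₂ (inj₂ (x , z))) (isRoot⇒rootV (σ (proj₁ x)) v isRoot≡)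

  αOccE-reflects : ∀ y e → αOccE y ≡ inj₁ e → y ≡ inj₂ (inj₁ e)
  αOccE-reflects (inj₁ (inj₁ c))  e ()
  αOccE-reflects (inj₁ (inj₂ nh)) e ()
  αOccE-reflects (inj₂ (inj₁ e)) .e refl = refl
  αOccE-reflects (inj₂ (inj₂ (x , e'))) e αy≡e with isTop (σ (proj₁ x)) e' | αy≡e
  ... | true  | ()
  ... | false | ()

  L-pullback : IsPullback tL α (idH (l °)) m
  L-pullback = reflecting⇒IsPullback-id tL α m α∘m≈tL
    (λ v a αv≡a → trans (cong Redex.toOccV (sym (αOcc-reflects (Redex.fromOccV v) a αv≡a))) (Redex.toOccV-from v))
    (λ e a αe≡a → trans (cong Redex.toOccE (sym (αOccE-reflects (Redex.fromOccE e) a αe≡a))) (Redex.toOccE-from e))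

  m-mono : Mono m
  m-mono = injective⇒Mono m
    (λ a b eq → inj₁-injective (trans (sym (proj₁ α∘m≈tL a)) (trans (cong (fV α) eq) (proj₁ α∘m≈tL b))))
    (λ a b eq → inj₁-injective (trans (sym (proj₂ α∘m≈tL a)) (trans (cong (fE α) eq) (proj₂ α∘m≈tL b))))
  -- the meet of a with the label of k, as ε is the only vertex of K' not labelled ⊤
  ℓGK : Lbl → V K' → Lbl
  ℓGK a (inj₁ (inj₁ _)) = bot
  ℓGK a (inj₁ (inj₂ _)) = a
  ℓGK a (inj₂ _)        = a

  ℓGK-≤ˡ : ∀ v k → ℓGK (ℓV (s °) v) k ≤L ℓV (s °) v
  ℓGK-≤ˡ v (inj₁ (inj₁ _)) = bot≤
  ℓGK-≤ˡ v (inj₁ (inj₂ _)) = ≤refl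
  ℓGK-≤ˡ v (inj₂ _)        = ≤refl

  ℓGK-≤ʳ : ∀ v k → ℓGK (ℓV (s °) v) k ≤L ℓV K' k
  ℓGK-≤ʳ v (inj₁ (inj₁ _)) = bot≤
  ℓGK-≤ʳ v (inj₁ (inj₂ _)) = ≤top
  ℓGK-≤ʳ v (inj₂ _)        = ≤top

  ℓGK-greatest : ∀ v k c → c ≤L ℓV (s °) v → c ≤L ℓV K' k → c ≤L ℓGK (ℓV (s °) v) k
  ℓGK-greatest v (inj₁ (inj₁ _)) c _   c≤k = c≤k
  ℓGK-greatest v (inj₁ (inj₂ _)) c c≤v _   = c≤v
  ℓGK-greatest v (inj₂ _)        c c≤v _   = c≤v

  ℓE-s≤ℓE-K' : ∀ (e : E (s °)) (e' : E K') → ℓE (s °) e ≤L ℓE K' e'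
  ℓE-s≤ℓE-K' e (inj₂ _) = ≤top

  module PB = CanonicalPullback α homl' (λ v k → ℓGK (ℓV (s °) v) k) (λ e _ → ℓE (s °) e)
    ℓGK-≤ˡ ℓGK-≤ʳ ℓGK-greatest (λ _ _ → ≤refl) ℓE-s≤ℓE-K' (λ _ _ _ c≤e _ → c≤e)

  GK : Graph
  GK = PB.P

  KV : Set
  KV = V ⌊ encI r ⌋

  u : Hom ⌊ encI r ⌋ GK
  u = record
    { fV = λ { (inj₁ tt) → fV m (rootV l) , inj₁ (inj₁ tt) , proj₁ α∘m≈tL (rootV l)
             ; (inj₂ x)  → fV m (inj₂ (varL x)) , inj₁ (inj₂ x) , proj₁ α∘m≈tL (inj₂ (varL x)) }
    ; fE = λ () ; src-comm = λ () ; tgt-comm = λ ()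
    ; ℓV-mono = λ { (inj₁ _) → bot≤ ; (inj₂ _) → bot≤ } ; ℓE-mono = λ () }

  w : Hom (r °) (t °)
  w = Reduct.patternHom

  rootR : Reduct.OccV
  rootR = inj₂ (patternV r (rootV r))

  -- A vertex of GK is a vertex a of s together with a vertex k of K' such that
  -- α a = l' k.  gR keeps a where it is if it lies in the context or in some σ x, and
  -- sends everything above the root ε of K' to the root of rσ.
  gRVar : (x' : Vars l) → Vert (σ (proj₁ x')) → (b : Bool) → (k : V K') → αVar x' b ≡ fV homl' k → Reduct.OccV
  gRVar x' v true (inj₁ (inj₁ _)) coh = rootR
  gRVar .(varL x) v true (inj₁ (inj₂ x)) refl = inj₂ (inj₂ (x , v))
  gRVar .(varL x) v false (inj₂ (inj₁ x)) refl = inj₂ (inj₂ (x , v))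
  gRVar x' v false (inj₁ (inj₁ _)) ()
  gRVar x' v false (inj₁ (inj₂ _)) ()
  gRVar x' v true (inj₂ (inj₁ _)) ()
  gRVar x' v true (inj₂ (inj₂ _)) ()

  gRCtx : CtxV C → (k : V K') → inj₂ (inj₂ tt) ≡ fV homl' k → Reduct.OccV
  gRCtx c (inj₁ (inj₁ _)) coh = rootR
  gRCtx c (inj₂ (inj₂ _)) coh = inj₁ c
  gRCtx c (inj₁ (inj₂ _)) ()
  gRCtx c (inj₂ (inj₁ _)) ()

  gROcc : (y : Redex.OccV) → (k : V K') → αOcc y ≡ fV homl' k → Reduct.OccV
  gROcc (inj₁ c) k coh = gRCtx c k coh
  gROcc (inj₂ (inj₁ q)) k coh = rootR
  gROcc (inj₂ (inj₂ (x' , v))) k coh = gRVar x' v (isRoot (σ (proj₁ x')) v) k coh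

  gROcc-root : ∀ y coh → gROcc y (inj₁ (inj₁ tt)) coh ≡ rootR
  gROcc-root (inj₁ c) coh = refl
  gROcc-root (inj₂ (inj₁ q)) coh = refl
  gROcc-root (inj₂ (inj₂ (x' , v))) coh with isRoot (σ (proj₁ x')) v | coh
  ... | true  | _  = refl
  ... | false | ()

  gREVar : (x' : Vars l) → Edge (σ (proj₁ x')) → (b : Bool) → (ke : E K') → αVarE x' b ≡ fE homl' ke → Reduct.OccE
  gREVar .(varL x) e true (inj₂ (inj₁ (inj₁ x))) refl = inj₂ (inj₂ (x , e))
  gREVar .(varL x) e false (inj₂ (inj₁ (inj₂ x))) refl = inj₂ (inj₂ (x , e))

  gROccE : (c : Redex.OccE) → (ke : E K') → αOccE c ≡ fE homl' ke → Reduct.OccE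
  gROccE (inj₁ (inj₁ c)) (inj₂ (inj₂ (inj₂ tt))) refl = inj₁ (inj₁ c)
  gROccE (inj₁ (inj₂ nh)) (inj₂ (inj₂ (inj₁ tt))) refl = inj₁ (inj₂ nh)
  gROccE (inj₂ (inj₂ (x' , e))) ke coh = gREVar x' e (isTop (σ (proj₁ x')) e) ke coh
  gROccE (inj₁ (inj₁ c)) (inj₂ (inj₁ (inj₁ _))) ()
  gROccE (inj₁ (inj₁ c)) (inj₂ (inj₁ (inj₂ _))) ()
  gROccE (inj₁ (inj₂ c)) (inj₂ (inj₁ (inj₁ _))) ()
  gROccE (inj₁ (inj₂ c)) (inj₂ (inj₁ (inj₂ _))) ()
  gROccE (inj₂ (inj₁ e)) (inj₂ (inj₁ (inj₁ _))) ()
  gROccE (inj₂ (inj₁ e)) (inj₂ (inj₁ (inj₂ _))) ()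
  gROccE (inj₂ (inj₁ e)) (inj₂ (inj₂ (inj₁ _))) ()
  gROccE (inj₂ (inj₁ e)) (inj₂ (inj₂ (inj₂ _))) ()

  gROcc-cong : ∀ {y y'} (eq : y ≡ y') k coh → gROcc y k coh ≡ gROcc y' k (trans (sym (cong αOcc eq)) coh)
  gROcc-cong refl k coh = refl

  gROccE-cong : ∀ {y y'} (eq : y ≡ y') k coh → gROccE y k coh ≡ gROccE y' k (trans (sym (cong αOccE eq)) coh)
  gROccE-cong refl k coh = refl

  module _ (x' : Vars l) where
    private σx = σ (proj₁ x')
    gRVar-src : ∀ (e : Edge σx) b ke (coh : αVarE x' b ≡ fE homl' ke) (coh′ : αVar x' b ≡ fV homl' (src K' ke)) →
             gRVar x' (srcT σx e) b (src K' ke) coh′ ≡ Reduct.occSrc (gREVar x' e b ke coh)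
    gRVar-src e true (inj₂ (inj₁ (inj₁ x))) refl refl = refl
    gRVar-src e false (inj₂ (inj₁ (inj₂ x))) refl refl = refl
    gRVar-src e true (inj₂ (inj₁ (inj₂ _))) () _
    gRVar-src e true (inj₂ (inj₂ _)) () _
    gRVar-src e false (inj₂ (inj₁ (inj₁ _))) () _
    gRVar-src e false (inj₂ (inj₂ _)) () _

    gRVar-tgt : ∀ (e : Edge σx) b ke (coh : αVarE x' b ≡ fE homl' ke) (coh′ : αVar x' false ≡ fV homl' (tgt K' ke)) →
             gRVar x' (tgtT σx e) false (tgt K' ke) coh′ ≡ Reduct.occTgt (gREVar x' e b ke coh)
    gRVar-tgt e true (inj₂ (inj₁ (inj₁ x))) refl refl = refl
    gRVar-tgt e false (inj₂ (inj₁ (inj₂ x))) refl refl = refl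
    gRVar-tgt e true (inj₂ (inj₁ (inj₂ _))) () _
    gRVar-tgt e true (inj₂ (inj₂ _)) () _
    gRVar-tgt e false (inj₂ (inj₁ (inj₁ _))) () _
    gRVar-tgt e false (inj₂ (inj₂ _)) () _

    gRVar-src′ : ∀ (e : Edge σx) ke (coh : αVarE x' (isTop σx e) ≡ fE homl' ke)
              (coh′ : αVar x' (isRoot σx (srcT σx e)) ≡ fV homl' (src K' ke)) →
              gRVar x' (srcT σx e) (isRoot σx (srcT σx e)) (src K' ke) coh′ ≡ Reduct.occSrc (gREVar x' e (isTop σx e) ke coh)
    gRVar-src′ e ke coh coh′ with isRoot σx (srcT σx e) | isRoot-src σx e | coh′
    ... | _ | refl | coh′ = gRVar-src e (isTop σx e) ke coh coh′

    gRVar-tgt′ : ∀ (e : Edge σx) ke (coh : αVarE x' (isTop σx e) ≡ fE homl' ke)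
              (coh′ : αVar x' (isRoot σx (tgtT σx e)) ≡ fV homl' (tgt K' ke)) →
              gRVar x' (tgtT σx e) (isRoot σx (tgtT σx e)) (tgt K' ke) coh′ ≡ Reduct.occTgt (gREVar x' e (isTop σx e) ke coh)
    gRVar-tgt′ e ke coh coh′ with isRoot σx (tgtT σx e) | isRoot-tgt σx e | coh′
    ... | _ | refl | coh′ = gRVar-tgt e (isTop σx e) ke coh coh′

  αVarE≢ctx : ∀ x' b {c} → αVarE x' b ≡ inj₂ (inj₂ c) → ⊥
  αVarE≢ctx x' true ()
  αVarE≢ctx x' false ()

  gROcc-src : ∀ c ke (coh : αOccE c ≡ fE homl' ke) (coh′ : αOcc (Redex.occSrc c) ≡ fV homl' (src K' ke)) →
            gROcc (Redex.occSrc c) (src K' ke) coh′ ≡ Reduct.occSrc (gROccE c ke coh)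
  gROcc-src (inj₁ (inj₁ c)) (inj₂ (inj₂ (inj₂ tt))) refl coh′ = refl
  gROcc-src (inj₁ (inj₂ nh)) (inj₂ (inj₂ (inj₁ tt))) refl coh′ = refl
  gROcc-src (inj₂ (inj₂ (x' , e))) ke@(inj₂ (inj₁ (inj₁ _))) coh coh′ = gRVar-src′ x' e ke coh coh′
  gROcc-src (inj₂ (inj₂ (x' , e))) ke@(inj₂ (inj₁ (inj₂ _))) coh coh′ = gRVar-src′ x' e ke coh coh′
  gROcc-src (inj₂ (inj₂ (x' , e))) ke@(inj₂ (inj₂ (inj₁ _))) coh coh′ = gRVar-src′ x' e ke coh coh′
  gROcc-src (inj₂ (inj₂ (x' , e))) ke@(inj₂ (inj₂ (inj₂ _))) coh coh′ = gRVar-src′ x' e ke coh coh′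
  gROcc-src (inj₁ (inj₁ c)) (inj₂ (inj₁ (inj₁ _))) () _
  gROcc-src (inj₁ (inj₁ c)) (inj₂ (inj₁ (inj₂ _))) () _
  gROcc-src (inj₁ (inj₂ c)) (inj₂ (inj₁ (inj₁ _))) () _
  gROcc-src (inj₁ (inj₂ c)) (inj₂ (inj₁ (inj₂ _))) () _
  gROcc-src (inj₁ (inj₁ c)) (inj₂ (inj₂ (inj₁ _))) () _
  gROcc-src (inj₁ (inj₂ c)) (inj₂ (inj₂ (inj₂ _))) () _
  gROcc-src (inj₂ (inj₁ e)) (inj₂ (inj₁ (inj₁ _))) () _
  gROcc-src (inj₂ (inj₁ e)) (inj₂ (inj₁ (inj₂ _))) () _
  gROcc-src (inj₂ (inj₁ e)) (inj₂ (inj₂ (inj₁ _))) () _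
  gROcc-src (inj₂ (inj₁ e)) (inj₂ (inj₂ (inj₂ _))) () _

  gROcc-tgt : ∀ c ke (coh : αOccE c ≡ fE homl' ke) (coh′ : αOcc (Redex.occTgt c) ≡ fV homl' (tgt K' ke)) →
            gROcc (Redex.occTgt c) (tgt K' ke) coh′ ≡ Reduct.occTgt (gROccE c ke coh)
  gROcc-tgt (inj₁ (inj₁ c)) (inj₂ (inj₂ (inj₂ tt))) refl coh′ = refl
  gROcc-tgt (inj₁ (inj₂ nh)) (inj₂ (inj₂ (inj₁ tt))) refl coh′ = gROcc-root (inj₂ (patternV l (rootV l))) coh′
  gROcc-tgt (inj₂ (inj₂ (x' , e))) ke@(inj₂ (inj₁ (inj₁ _))) coh coh′ = gRVar-tgt′ x' e ke coh coh′
  gROcc-tgt (inj₂ (inj₂ (x' , e))) ke@(inj₂ (inj₁ (inj₂ _))) coh coh′ = gRVar-tgt′ x' e ke coh coh′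
  gROcc-tgt (inj₂ (inj₂ (x' , e))) ke@(inj₂ (inj₂ (inj₂ _))) coh coh′ = gRVar-tgt′ x' e ke coh coh′
  gROcc-tgt (inj₂ (inj₂ (x' , e))) (inj₂ (inj₂ (inj₁ c))) coh coh′ = ⊥-elim (αVarE≢ctx x' _ coh)
  gROcc-tgt (inj₁ (inj₁ c)) (inj₂ (inj₁ (inj₁ _))) () _
  gROcc-tgt (inj₁ (inj₁ c)) (inj₂ (inj₁ (inj₂ _))) () _
  gROcc-tgt (inj₁ (inj₂ c)) (inj₂ (inj₁ (inj₁ _))) () _
  gROcc-tgt (inj₁ (inj₂ c)) (inj₂ (inj₁ (inj₂ _))) () _
  gROcc-tgt (inj₁ (inj₁ c)) (inj₂ (inj₂ (inj₁ _))) () _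
  gROcc-tgt (inj₁ (inj₂ c)) (inj₂ (inj₂ (inj₂ _))) () _
  gROcc-tgt (inj₂ (inj₁ e)) (inj₂ (inj₁ (inj₁ _))) () _
  gROcc-tgt (inj₂ (inj₁ e)) (inj₂ (inj₁ (inj₂ _))) () _
  gROcc-tgt (inj₂ (inj₁ e)) (inj₂ (inj₂ (inj₁ _))) () _
  gROcc-tgt (inj₂ (inj₁ e)) (inj₂ (inj₂ (inj₂ _))) () _

  gRVar-ℓ : ∀ x' v b k (coh : αVar x' b ≡ fV homl' k) →
             ℓGK (ℓV (σ (proj₁ x') °) v) k ≤L Reduct.occℓV (gRVar x' v b k coh)
  gRVar-ℓ x' v true (inj₁ (inj₁ _)) coh = bot≤
  gRVar-ℓ .(varL x) v true (inj₁ (inj₂ x)) refl = ≤refl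
  gRVar-ℓ .(varL x) v false (inj₂ (inj₁ x)) refl = ≤refl
  gRVar-ℓ x' v false (inj₁ (inj₁ _)) ()
  gRVar-ℓ x' v false (inj₁ (inj₂ _)) ()
  gRVar-ℓ x' v true (inj₂ (inj₁ _)) ()
  gRVar-ℓ x' v true (inj₂ (inj₂ _)) ()

  gROcc-ℓ : ∀ y k (coh : αOcc y ≡ fV homl' k) → ℓGK (Redex.occℓV y) k ≤L Reduct.occℓV (gROcc y k coh)
  gROcc-ℓ y (inj₁ (inj₁ _)) coh = bot≤
  gROcc-ℓ (inj₁ c) (inj₂ (inj₂ _)) coh = ≤refl
  gROcc-ℓ (inj₂ (inj₂ (x' , v))) (inj₁ (inj₂ x)) coh = gRVar-ℓ x' v _ (inj₁ (inj₂ x)) coh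
  gROcc-ℓ (inj₂ (inj₂ (x' , v))) (inj₂ k) coh = gRVar-ℓ x' v _ (inj₂ k) coh
  gROcc-ℓ (inj₁ c) (inj₁ (inj₂ _)) ()
  gROcc-ℓ (inj₁ c) (inj₂ (inj₁ _)) ()
  gROcc-ℓ (inj₂ (inj₁ q)) (inj₁ (inj₂ _)) ()
  gROcc-ℓ (inj₂ (inj₁ q)) (inj₂ (inj₁ _)) ()
  gROcc-ℓ (inj₂ (inj₁ q)) (inj₂ (inj₂ _)) ()

  gREVar-ℓ : ∀ x' (e : Edge (σ (proj₁ x'))) b ke (coh : αVarE x' b ≡ fE homl' ke) →
              ℓEdge (σ (proj₁ x')) e ≤L Reduct.occℓE (gREVar x' e b ke coh)
  gREVar-ℓ .(varL x) e true (inj₂ (inj₁ (inj₁ x))) refl = ≤refl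
  gREVar-ℓ .(varL x) e false (inj₂ (inj₁ (inj₂ x))) refl = ≤refl
  gREVar-ℓ x' e true (inj₂ (inj₁ (inj₂ _))) ()
  gREVar-ℓ x' e true (inj₂ (inj₂ _)) ()
  gREVar-ℓ x' e false (inj₂ (inj₁ (inj₁ _))) ()
  gREVar-ℓ x' e false (inj₂ (inj₂ _)) ()

  gROccE-ℓ : ∀ c ke (coh : αOccE c ≡ fE homl' ke) → Redex.occℓE c ≤L Reduct.occℓE (gROccE c ke coh)
  gROccE-ℓ (inj₁ (inj₁ c)) (inj₂ (inj₂ (inj₂ tt))) refl = ≤refl
  gROccE-ℓ (inj₁ (inj₂ nh)) (inj₂ (inj₂ (inj₁ tt))) refl = ≤refl
  gROccE-ℓ (inj₂ (inj₂ (x' , e))) ke coh = gREVar-ℓ x' e _ ke coh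
  gROccE-ℓ (inj₁ (inj₁ c)) (inj₂ (inj₁ (inj₁ _))) ()
  gROccE-ℓ (inj₁ (inj₁ c)) (inj₂ (inj₁ (inj₂ _))) ()
  gROccE-ℓ (inj₁ (inj₂ c)) (inj₂ (inj₁ (inj₁ _))) ()
  gROccE-ℓ (inj₁ (inj₂ c)) (inj₂ (inj₁ (inj₂ _))) ()
  gROccE-ℓ (inj₁ (inj₁ c)) (inj₂ (inj₂ (inj₁ _))) ()
  gROccE-ℓ (inj₁ (inj₂ c)) (inj₂ (inj₂ (inj₂ _))) ()
  gROccE-ℓ (inj₂ (inj₁ e)) (inj₂ (inj₁ (inj₁ _))) ()
  gROccE-ℓ (inj₂ (inj₁ e)) (inj₂ (inj₁ (inj₂ _))) ()
  gROccE-ℓ (inj₂ (inj₁ e)) (inj₂ (inj₂ (inj₁ _))) ()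
  gROccE-ℓ (inj₂ (inj₁ e)) (inj₂ (inj₂ (inj₂ _))) ()

  gR : Hom GK (t °)
  gR = record
    { fV = λ { (a , k , coh) → Reduct.toOccV (gROcc (Redex.fromOccV a) k coh) }
    ; fE = λ { (e , ke , coh) → Reduct.toOccE (gROccE (Redex.fromOccE e) ke coh) }
    ; src-comm = λ { (e , ke , coh) →
        trans (cong Reduct.toOccV (trans (gROcc-cong (Redex.fromOccV-src e) (src K' ke) _) (gROcc-src (Redex.fromOccE e) ke coh _)))
              (sym (Reduct.src-toOccE (gROccE (Redex.fromOccE e) ke coh))) }
    ; tgt-comm = λ { (e , ke , coh) →
        trans (cong Reduct.toOccV (trans (gROcc-cong (Redex.fromOccV-tgt e) (tgt K' ke) _) (gROcc-tgt (Redex.fromOccE e) ke coh _)))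
              (sym (Reduct.tgt-toOccE (gROccE (Redex.fromOccE e) ke coh))) }
    ; ℓV-mono = λ { (a , k , coh) → ≤L-≡ˡ (cong (λ z → ℓGK z k) (Redex.ℓV-fromOccV a))
                      (≤L-≡ʳ (gROcc-ℓ (Redex.fromOccV a) k coh) (sym (Reduct.ℓV-toOccV (gROcc (Redex.fromOccV a) k coh)))) }
    ; ℓE-mono = λ { (e , ke , coh) → ≤L-≡ˡ (Redex.ℓE-fromOccE e)
                      (≤L-≡ʳ (gROccE-ℓ (Redex.fromOccE e) ke coh) (sym (Reduct.ℓE-toOccE (gROccE (Redex.fromOccE e) ke coh)))) } }

  gRVar-rootK : ∀ x v b → b ≡ true → (coh : αVar (varL x) b ≡ fV homl' (inj₁ (inj₂ x))) →
          gRVar (varL x) v b (inj₁ (inj₂ x)) coh ≡ inj₂ (inj₂ (x , v))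
  gRVar-rootK x v .true refl refl = refl

  comm : (gR ∘H u) ≈H (w ∘H homr)
  comm = comm-V , (λ ())
    where
    comm-V : ∀ k → fV gR (fV u k) ≡ fV w (fV homr k)
    comm-V (inj₁ tt) = cong Reduct.toOccV (gROcc-root (Redex.fromOccV (fV m (rootV l))) (proj₁ α∘m≈tL (rootV l)))
    comm-V (inj₂ x) = cong Reduct.toOccV (trans (gROcc-cong (Redex.fromOccV-to (patternOcc (inj₂ (varL x)))) (inj₁ (inj₂ x)) _)
                                     (gRVar-rootK x _ _ (isRoot-rootV (σ (proj₁ x))) _))

  kVar : Vars r → Bool → V K'
  kVar x true = inj₁ (inj₂ x)
  kVar x false = inj₂ (inj₁ x)
  αVar-kVar : ∀ x b → αVar (varL x) b ≡ fV homl' (kVar x b)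
  αVar-kVar x true = refl
  αVar-kVar x false = refl
  kVarE : Vars r → Bool → E K'
  kVarE x true = inj₂ (inj₁ (inj₁ x))
  kVarE x false = inj₂ (inj₁ (inj₂ x))
  αVarE-kVarE : ∀ x b → αVarE (varL x) b ≡ fE homl' (kVarE x b)
  αVarE-kVarE x true = refl
  αVarE-kVarE x false = refl

  splitOcc : Reduct.OccV → PB.PbV ⊎ V (r °)
  splitOcc (inj₁ c) = inj₁ (Redex.toOccV (inj₁ c) , inj₂ (inj₂ tt) , cong αOcc (Redex.fromOccV-to (inj₁ c)))
  splitOcc (inj₂ (inj₁ q)) = inj₂ (inj₁ q)
  splitOcc (inj₂ (inj₂ (x , v))) = inj₁ (Redex.toOccV (inj₂ (inj₂ (varL x , v))) , kVar x (isRoot (σ (proj₁ x)) v) ,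
                                    trans (cong αOcc (Redex.fromOccV-to (inj₂ (inj₂ (varL x , v))))) (αVar-kVar x _))

  splitOccE : Reduct.OccE → PB.PbE ⊎ E (r °)
  splitOccE (inj₁ (inj₁ c)) =
    inj₁ (Redex.toOccE (inj₁ (inj₁ c)) , inj₂ (inj₂ (inj₂ tt)) , cong αOccE (Redex.fromOccE-to (inj₁ (inj₁ c))))
  splitOccE (inj₁ (inj₂ nh)) =
    inj₁ (Redex.toOccE (inj₁ (inj₂ nh)) , inj₂ (inj₂ (inj₁ tt)) , cong αOccE (Redex.fromOccE-to (inj₁ (inj₂ nh))))
  splitOccE (inj₂ (inj₁ e)) = inj₂ e
  splitOccE (inj₂ (inj₂ (x , e))) = inj₁ (Redex.toOccE (inj₂ (inj₂ (varL x , e))) , kVarE x (isTop (σ (proj₁ x)) e) ,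
                                    trans (cong αOccE (Redex.fromOccE-to (inj₂ (inj₂ (varL x , e))))) (αVarE-kVarE x _))

  splitV : V (t °) → PB.PbV ⊎ V (r °)
  splitV v = splitOcc (Reduct.fromOccV v)
  splitE : E (t °) → PB.PbE ⊎ E (r °)
  splitE e = splitOccE (Reduct.fromOccE e)

  gRVar-kVar : ∀ x v b coh → gRVar (varL x) v b (kVar x b) coh ≡ inj₂ (inj₂ (x , v))
  gRVar-kVar x v true refl = refl
  gRVar-kVar x v false refl = refl

  splitOcc-section : ∀ y → [ fV gR , fV w ]′ (splitOcc y) ≡ Reduct.toOccV y
  splitOcc-section (inj₁ c) = cong Reduct.toOccV (gROcc-cong (Redex.fromOccV-to (inj₁ c)) (inj₂ (inj₂ tt)) _)
  splitOcc-section (inj₂ (inj₁ q)) = refl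
  splitOcc-section (inj₂ (inj₂ (x , v))) = cong Reduct.toOccV
    (trans (gROcc-cong (Redex.fromOccV-to (inj₂ (inj₂ (varL x , v)))) _ _) (gRVar-kVar x v _ _))

  splitV-section : ∀ v → [ fV gR , fV w ]′ (splitV v) ≡ v
  splitV-section v = trans (splitOcc-section (Reduct.fromOccV v)) (Reduct.toOccV-from v)

  gROccE-ctx : ∀ c coh → gROccE (inj₁ (inj₁ c)) (inj₂ (inj₂ (inj₂ tt))) coh ≡ inj₁ (inj₁ c)
  gROccE-ctx c refl = refl
  gROccE-hole : ∀ c coh → gROccE (inj₁ (inj₂ c)) (inj₂ (inj₂ (inj₁ tt))) coh ≡ inj₁ (inj₂ c)
  gROccE-hole c refl = refl
  gREVar-kVarE : ∀ x e b coh → gREVar (varL x) e b (kVarE x b) coh ≡ inj₂ (inj₂ (x , e))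
  gREVar-kVarE x e true refl = refl
  gREVar-kVarE x e false refl = refl

  splitOccE-section : ∀ y → [ fE gR , fE w ]′ (splitOccE y) ≡ Reduct.toOccE y
  splitOccE-section (inj₁ (inj₁ c)) =
    cong Reduct.toOccE (trans (gROccE-cong eq _ _) (gROccE-ctx c (trans (sym (cong αOccE eq)) (cong αOccE eq))))
    where eq = Redex.fromOccE-to (inj₁ (inj₁ c))
  splitOccE-section (inj₁ (inj₂ nh)) =
    cong Reduct.toOccE (trans (gROccE-cong eq _ _) (gROccE-hole nh (trans (sym (cong αOccE eq)) (cong αOccE eq))))
    where eq = Redex.fromOccE-to (inj₁ (inj₂ nh))
  splitOccE-section (inj₂ (inj₁ e)) = refl
  splitOccE-section (inj₂ (inj₂ (x , e))) = cong Reduct.toOccE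
    (trans (gROccE-cong (Redex.fromOccE-to (inj₂ (inj₂ (varL x , e)))) _ _) (gREVar-kVarE x e _ _))

  splitE-section : ∀ e → [ fE gR , fE w ]′ (splitE e) ≡ e
  splitE-section e = trans (splitOccE-section (Reduct.fromOccE e)) (Reduct.toOccE-from e)

  ℓGK-kVar : ∀ z x b → ℓGK z (kVar x b) ≡ z
  ℓGK-kVar z x true = refl
  ℓGK-kVar z x false = refl

  splitOcc-ℓ : ∀ y → Reduct.occℓV y ≤L [ ℓV GK , ℓV (r °) ]′ (splitOcc y)
  splitOcc-ℓ (inj₁ c) = ≤L-≡ʳ ≤refl (sym (Redex.ℓV-toOccV (inj₁ c)))
  splitOcc-ℓ (inj₂ (inj₁ q)) = ≤refl
  splitOcc-ℓ (inj₂ (inj₂ (x , v))) =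
    ≤L-≡ʳ ≤refl (sym (trans (ℓGK-kVar _ x _) (Redex.ℓV-toOccV (inj₂ (inj₂ (varL x , v))))))

  splitV-ℓ : ∀ v → ℓV (t °) v ≤L [ ℓV GK , ℓV (r °) ]′ (splitV v)
  splitV-ℓ v = ≤L-≡ˡ (Reduct.ℓV-fromOccV v) (splitOcc-ℓ (Reduct.fromOccV v))

  splitOccE-ℓ : ∀ y → Reduct.occℓE y ≤L [ ℓE GK , ℓE (r °) ]′ (splitOccE y)
  splitOccE-ℓ (inj₁ (inj₁ c)) = ≤L-≡ʳ ≤refl (sym (Redex.ℓE-toOccE (inj₁ (inj₁ c))))
  splitOccE-ℓ (inj₁ (inj₂ c)) = ≤L-≡ʳ ≤refl (sym (Redex.ℓE-toOccE (inj₁ (inj₂ c))))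
  splitOccE-ℓ (inj₂ (inj₁ e)) = ≤refl
  splitOccE-ℓ (inj₂ (inj₂ (x , e))) = ≤L-≡ʳ ≤refl (sym (Redex.ℓE-toOccE (inj₂ (inj₂ (varL x , e)))))

  splitE-ℓ : ∀ e → ℓE (t °) e ≤L [ ℓE GK , ℓE (r °) ]′ (splitE e)
  splitE-ℓ e = ≤L-≡ˡ (Reduct.ℓE-fromOccE e) (splitOccE-ℓ (Reduct.fromOccE e))


  SplitGK : PB.PbV → Set
  SplitGK g = (splitV (fV gR g) ≡ inj₁ g)
       ⊎ (Σ KV λ k → Σ KV λ k' →
            (g ≡ fV u k) × (splitV (fV gR g) ≡ inj₁ (fV u k')) × (fV homr k ≡ fV homr k'))
       ⊎ (Σ KV λ k → (g ≡ fV u k) × (splitV (fV gR g) ≡ inj₂ (fV homr k)))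

  splitOcc-pattern : ∀ b → (splitOcc (inj₂ (patternV r b)) ≡ inj₂ b) ⊎
                 (Σ KV λ k' → (splitOcc (inj₂ (patternV r b)) ≡ inj₁ (fV u k')) × (fV homr k' ≡ b))
  splitOcc-pattern (inj₁ q) = inj₁ refl
  splitOcc-pattern (inj₂ x) = inj₂ (inj₂ x , cong inj₁ (PB.Pb-≡ refl (cong (kVar x) (isRoot-rootV (σ (proj₁ x))))) , refl)

  splitV-gR-root : ∀ a coh → a ≡ fV m (rootV l) →
                   splitV (fV gR (a , inj₁ (inj₁ tt) , coh)) ≡ splitOcc rootR → SplitGK (a , inj₁ (inj₁ tt) , coh)
  splitV-gR-root a coh a≡m split≡ with splitOcc-pattern (rootV r)
  ... | inj₁ e = inj₂ (inj₂ (inj₁ tt , PB.Pb-≡ a≡m refl , trans split≡ e))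
  ... | inj₂ (k' , e , eq) = inj₂ (inj₁ (inj₁ tt , k' , PB.Pb-≡ a≡m refl , trans split≡ e , sym eq))

  splitV-gR-var : ∀ a k coh (x' : Vars l) (v : Vert (σ (proj₁ x'))) b → isRoot (σ (proj₁ x')) v ≡ b →
            (cohʸ : αVar x' b ≡ fV homl' k) →
            splitV (fV gR (a , k , coh)) ≡ splitOcc (gRVar x' v b k cohʸ) →
            a ≡ Redex.toOccV (inj₂ (inj₂ (x' , v))) → SplitGK (a , k , coh)
  splitV-gR-var a (inj₁ (inj₁ tt)) coh x' v true isRoot≡ cohʸ split≡ a≡ =
    splitV-gR-root a coh
      (trans a≡ (cong Redex.toOccV (αOcc-reflects (inj₂ (inj₂ (x' , v))) (rootV l) (trans (cong (αVar x') isRoot≡) cohʸ))))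
      split≡
  splitV-gR-var a (inj₁ (inj₂ x)) coh .(varL x) v true isRoot≡ refl split≡ a≡ =
    inj₁ (trans split≡ (cong inj₁ (PB.Pb-≡ (sym a≡) (cong (kVar x) isRoot≡))))
  splitV-gR-var a (inj₂ (inj₁ x)) coh .(varL x) v false isRoot≡ refl split≡ a≡ =
    inj₁ (trans split≡ (cong inj₁ (PB.Pb-≡ (sym a≡) (cong (kVar x) isRoot≡))))
  splitV-gR-var a (inj₁ (inj₁ _)) coh x' v false isRoot≡ () split≡ a≡
  splitV-gR-var a (inj₁ (inj₂ _)) coh x' v false isRoot≡ () split≡ a≡
  splitV-gR-var a (inj₂ (inj₁ _)) coh x' v true isRoot≡ () split≡ a≡
  splitV-gR-var a (inj₂ (inj₂ _)) coh x' v true isRoot≡ () split≡ a≡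
  splitV-gR-var a (inj₂ (inj₂ _)) coh x' v false isRoot≡ () split≡ a≡

  splitV-gR-occ : ∀ a k coh y → a ≡ Redex.toOccV y → (cohʸ : αOcc y ≡ fV homl' k) →
          splitV (fV gR (a , k , coh)) ≡ splitOcc (gROcc y k cohʸ) → SplitGK (a , k , coh)
  splitV-gR-occ a (inj₁ (inj₁ tt)) coh y a≡ cohʸ split≡ =
    splitV-gR-root a coh (trans a≡ (cong Redex.toOccV (αOcc-reflects y (rootV l) cohʸ)))
                         (trans split≡ (cong splitOcc (gROcc-root y cohʸ)))
  splitV-gR-occ a (inj₂ (inj₂ tt)) coh (inj₁ c) a≡ cohʸ split≡ =
    inj₁ (trans split≡ (cong inj₁ (PB.Pb-≡ (sym a≡) refl)))
  splitV-gR-occ a k coh (inj₂ (inj₂ (x' , v))) a≡ cohʸ split≡ = splitV-gR-var a k coh x' v _ refl cohʸ split≡ a≡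
  splitV-gR-occ a (inj₁ (inj₂ _)) coh (inj₁ c) a≡ () split≡
  splitV-gR-occ a (inj₂ (inj₁ _)) coh (inj₁ c) a≡ () split≡
  splitV-gR-occ a (inj₁ (inj₂ _)) coh (inj₂ (inj₁ q)) a≡ () split≡
  splitV-gR-occ a (inj₂ (inj₁ _)) coh (inj₂ (inj₁ q)) a≡ () split≡
  splitV-gR-occ a (inj₂ (inj₂ _)) coh (inj₂ (inj₁ q)) a≡ () split≡

  splitV-gR : ∀ g → SplitGK g
  splitV-gR (a , k , coh) = splitV-gR-occ a k coh (Redex.fromOccV a) (sym (Redex.toOccV-from a)) coh
                         (cong splitOcc (Reduct.fromOccV-to (gROcc (Redex.fromOccV a) k coh)))

  splitV-w : ∀ b → (splitV (fV w b) ≡ inj₂ b)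
                 ⊎ (Σ KV λ k' → (splitV (fV w b) ≡ inj₁ (fV u k')) × (fV homr k' ≡ b))
  splitV-w b with splitOcc-pattern b
  ... | inj₁ e = inj₁ (trans (cong splitOcc (Reduct.fromOccV-to (inj₂ (patternV r b)))) e)
  ... | inj₂ (k' , e , eq) = inj₂ (k' , trans (cong splitOcc (Reduct.fromOccV-to (inj₂ (patternV r b)))) e , eq)

  splitE-gR-var : ∀ e ke coh (x' : Vars l) (e' : Edge (σ (proj₁ x'))) b → isTop (σ (proj₁ x')) e' ≡ b →
           (cohʸ : αVarE x' b ≡ fE homl' ke) →
           splitE (fE gR (e , ke , coh)) ≡ splitOccE (gREVar x' e' b ke cohʸ) → e ≡ Redex.toOccE (inj₂ (inj₂ (x' , e'))) →
           splitE (fE gR (e , ke , coh)) ≡ inj₁ (e , ke , coh)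
  splitE-gR-var e (inj₂ (inj₁ (inj₁ x))) coh .(varL x) e' true isRoot≡ refl split≡ e≡ =
    trans split≡ (cong inj₁ (PB.Pb-≡ (sym e≡) (cong (kVarE x) isRoot≡)))
  splitE-gR-var e (inj₂ (inj₁ (inj₂ x))) coh .(varL x) e' false isRoot≡ refl split≡ e≡ =
    trans split≡ (cong inj₁ (PB.Pb-≡ (sym e≡) (cong (kVarE x) isRoot≡)))
  splitE-gR-var e (inj₂ (inj₁ (inj₂ _))) coh x' e' true isRoot≡ () split≡ e≡
  splitE-gR-var e (inj₂ (inj₂ _)) coh x' e' true isRoot≡ () split≡ e≡
  splitE-gR-var e (inj₂ (inj₁ (inj₁ _))) coh x' e' false isRoot≡ () split≡ e≡
  splitE-gR-var e (inj₂ (inj₂ _)) coh x' e' false isRoot≡ () split≡ e≡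

  splitE-gR-occ : ∀ e ke coh y → e ≡ Redex.toOccE y → (cohʸ : αOccE y ≡ fE homl' ke) →
         splitE (fE gR (e , ke , coh)) ≡ splitOccE (gROccE y ke cohʸ) → splitE (fE gR (e , ke , coh)) ≡ inj₁ (e , ke , coh)
  splitE-gR-occ e (inj₂ (inj₂ (inj₂ tt))) coh (inj₁ (inj₁ c)) e≡ refl split≡ =
    trans split≡ (cong inj₁ (PB.Pb-≡ (sym e≡) refl))
  splitE-gR-occ e (inj₂ (inj₂ (inj₁ tt))) coh (inj₁ (inj₂ c)) e≡ refl split≡ =
    trans split≡ (cong inj₁ (PB.Pb-≡ (sym e≡) refl))
  splitE-gR-occ e ke coh (inj₂ (inj₂ (x' , e'))) e≡ cohʸ split≡ = splitE-gR-var e ke coh x' e' _ refl cohʸ split≡ e≡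
  splitE-gR-occ e (inj₂ (inj₁ (inj₁ _))) coh (inj₁ (inj₁ c)) e≡ () split≡
  splitE-gR-occ e (inj₂ (inj₁ (inj₂ _))) coh (inj₁ (inj₁ c)) e≡ () split≡
  splitE-gR-occ e (inj₂ (inj₁ (inj₁ _))) coh (inj₁ (inj₂ c)) e≡ () split≡
  splitE-gR-occ e (inj₂ (inj₁ (inj₂ _))) coh (inj₁ (inj₂ c)) e≡ () split≡
  splitE-gR-occ e (inj₂ (inj₂ (inj₁ _))) coh (inj₁ (inj₁ c)) e≡ () split≡
  splitE-gR-occ e (inj₂ (inj₂ (inj₂ _))) coh (inj₁ (inj₂ c)) e≡ () split≡
  splitE-gR-occ e (inj₂ (inj₁ (inj₁ _))) coh (inj₂ (inj₁ e')) e≡ () split≡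
  splitE-gR-occ e (inj₂ (inj₁ (inj₂ _))) coh (inj₂ (inj₁ e')) e≡ () split≡
  splitE-gR-occ e (inj₂ (inj₂ (inj₁ _))) coh (inj₂ (inj₁ e')) e≡ () split≡
  splitE-gR-occ e (inj₂ (inj₂ (inj₂ _))) coh (inj₂ (inj₁ e')) e≡ () split≡

  splitE-gR : ∀ ge → splitE (fE gR ge) ≡ inj₁ ge
  splitE-gR (e , ke , coh) = splitE-gR-occ e ke coh (Redex.fromOccE e) (sym (Redex.toOccE-from e)) coh
                        (cong splitOccE (Reduct.fromOccE-to (gROccE (Redex.fromOccE e) ke coh)))

  splitE-w : ∀ e → splitE (fE w e) ≡ inj₂ e
  splitE-w e = cong splitOccE (Reduct.fromOccE-to (inj₂ (inj₁ e)))

  module Pushout = PushoutBySplitting u homr gR w comm splitV splitE splitV-section splitE-section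
                                       splitV-ℓ splitE-ℓ splitV-gR splitV-w splitE-gR splitE-w

  match-at-hole : ∀ u → IsFun u → Σ (FunPos (plug C (u [ σ ]))) λ v →
                  (funPos (plug C (u [ σ ])) v ≡ holePos C) ×
                  (toPlugV C (u [ σ ]) (inj₂ (toInstV u (patternV u (rootV u)))) ≡ inj₁ v)
  match-at-hole (fun f ts) _ with funPos-toPlugV C (fun f ts [ σ ]) (inj₁ tt)
  ... | q , eq , pos = q , trans pos (++-identityʳ (holePos C)) , eq

  step : PStepAt ρ s t (holePos C)
  step = record
    { m = m
    ; m-mono = m-mono
    ; α = α
    ; α∘m≈tL = α∘m≈tL
    ; L-pb = L-pullback
    ; GK = GK
    ; gL = PB.p₁
    ; u' = PB.p₂
    ; K-pb = PB.isPullback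
    ; u = u
    ; u'∘u = (λ { (inj₁ tt) → refl ; (inj₂ x) → refl }) , (λ ())
    ; gL∘u = (λ { (inj₁ tt) → refl ; (inj₂ x) → refl }) , (λ ())
    ; gR = gR
    ; w = w
    ; R-po = Pushout.isPushout
    ; match = match-at-hole l lhs-nonvar }

lemma33 : (𝕊 : Signature) → let open Sig 𝕊 in
    (ρ : TRule) → Linear (TRule.lhs ρ) → Linear (TRule.rhs ρ) →
    (s t : Term) → Linear s → Linear t → (p : Pos) →
    RewStep ρ s t p → PStepAt ρ s t p
lemma33 𝕊 ρ linl linr s t lins lint p (C , σ , refl , refl , refl) =
  Simulation.step 𝕊 ρ σ C linl linr lins lint
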